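{- Let $(G=(V,E),L,c,r,e_r)$ be a rooted WRAP instance with non-shortenable directed WRAP solution $\vec F\subseteq\mathrm{Shadows}(L)$, and let $S\subseteq L$ be such that the link intersection graph $H[S]$ of $S$ is connected. Then $$\mathrm{Drop}_{\vec F}(S)=\Big(\bigcup_{v\in V(S)}\delta^-_{\vec F}(v)\Big)\setminus\delta^-_{\vec F}(\mathrm{lca}(V(S))).$$
   Context: Rooted WRAP instance: cycle $G=(V,E)$, links $L\subseteq\binom V2$, costs $c$, root $r$, edge $e_r\in E$ at $r$. $\mathcal C_G=\{C\subseteq V\setminus\{r\}:|\delta_E(C)|=2\}$; $\delta_F(U)$ = elements of $F$ with exactly one endpoint in $U$; $\delta^-_{\vec F}(v)$ = links of $\vec F$ with head $v$. Directed link $(u,v)$ covers $C\in\mathcal C_G$ if $v\in C,u\notin C$; a directed WRAP solution covers every $C\in\mathcal C_G$. Shortening of $(u,v)$: $(s,v)$, $s\ne v$, $s$ on the $u$-$v$ path of $(V,E\setminus\{e_r\})$ (strict if $s\ne u$); shadows of $\{u,v\}$: shortenings of $(u,v)$ or $(v,u)$. Non-shortenable: deleting or strictly shortening any link destroys feasibility; then $(V,\vec F)$ is an arborescence rooted at $r$. $(u,v)\in\vec F$ is responsible for $C\in\mathcal C_G$ if it covers $C$ and no link on the $r$-$u$ path in $(V,\vec F)$ covers $C$; $\mathrm{Drop}_{\vec F}(K)$ is the set of $\vec\ell\in\vec F$ such that every $C$ for which $\vec\ell$ is responsible satisfies $\delta_K(C)\ne\emptyset$. Two links intersect if they share an endpoint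 or cross (share no endpoint and each of the two paths of $G$ between the endpoints of one contains an endpoint of the other); $H[S]$ has vertex set $S$ and edges between intersecting links. $V(S)$ is the set of endpoints of links in $S$. $\mathrm{lca}(U)$ is the vertex farthest from $r$ in $(V,\vec F)$ that is an ancestor (a vertex is its own ancestor) of every vertex of $U$. -}

module Defs where

open import Data.Nat using (ℕ; zero; suc; _+_; _∸_; _≤_; _≤ᵇ_; _≡ᵇ_)
open import Data.Bool using (Bool; true; false; if_then_else_; _∧_; _xor_)
open import Data.Fin using (Fin; toℕ)
open import Data.List using (List; map; allFin)
open import Data.Nat.ListAction using (sum)
open import Data.Product using (Σ; ∃; ∃-syntax; _×_; _,_)
open import Data.Sum using (_⊎_)
open import Relation.Binary.PropositionalEquality using (_≡_; _≢_)
open import Relation.Nullary using (¬_)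

-- The cycle G on V = Fin n, n ≥ 3: edges {x , x+1 mod n}.

fwd : {n : ℕ} → Fin n → Fin n → ℕ
fwd {n} x y =
  if toℕ x ≤ᵇ toℕ y then toℕ y ∸ toℕ x else (n + toℕ y) ∸ toℕ x

-- (x , y) is an edge of G oriented along the cycle (y = x+1 mod n);
-- for n ≥ 3 every edge of G has exactly one such orientation.
isEdgeᵇ : {n : ℕ} → Fin n → Fin n → Bool
isEdgeᵇ x y = fwd x y ≡ᵇ 1

VSet : ℕ → Set
VSet n = Fin n → Bool

DLinks : ℕ → Set
DLinks n = Fin n → Fin n → Bool

-- undirected link sets: symmetric indicator, {u , v} ∈ S iff S u v ≡ true
ULinks : ℕ → Set
ULinks n = Fin n → Fin n → Bool

_∈V_ : {n : ℕ} → Fin n → VSet n → Set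
x ∈V C = C x ≡ true

IsLinkSet : {n : ℕ} → ULinks n → Set
IsLinkSet {n} L = (∀ (u v : Fin n) → L u v ≡ L v u) × (∀ (u : Fin n) → L u u ≡ false)

cutSize : {n : ℕ} → VSet n → ℕ
cutSize {n} C =
  sum (map (λ x → sum (map (λ y →
    if isEdgeᵇ x y ∧ (C x xor C y) then 1 else 0) (allFin n))) (allFin n))

InCG : {n : ℕ} → Fin n → VSet n → Set
InCG r C = (C r ≡ false) × (cutSize C ≡ 2)

-- The path (V , E ∖ {e_r}), where e_r = {ea , eb} with eb = ea+1 mod n.
-- Its vertices are linearly ordered by pos x = fwd eb x (eb first, ea last).

OnPath : {n : ℕ} → (ea eb : Fin n) → Fin n → Fin n → Fin n → Set
OnPath ea eb s u v =
  (fwd eb u ≤ fwd eb s × fwd eb s ≤ fwd eb v) ⊎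
  (fwd eb v ≤ fwd eb s × fwd eb s ≤ fwd eb u)

IsShortening : {n : ℕ} → (ea eb : Fin n) →
               (u v : Fin n) → (s v' : Fin n) → Set
IsShortening ea eb u v s v' = (v' ≡ v) × (s ≢ v) × OnPath ea eb s u v

InShadows : {n : ℕ} → (ea eb : Fin n) → ULinks n → Fin n → Fin n → Set
InShadows ea eb L x y =
  ∃[ u ] ∃[ v ] (L u v ≡ true ×
    (IsShortening ea eb u v x y ⊎ IsShortening ea eb v u x y))

Covers : {n : ℕ} → Fin n → Fin n → VSet n → Set
Covers u v C = (C v ≡ true) × (C u ≡ false)

Feasible : {n : ℕ} → Fin n → DLinks n → Set
Feasible r F = ∀ C → InCG r C → ∃[ u ] ∃[ v ] (F u v ≡ true × Covers u v C)

delete : {n : ℕ} → DLinks n → Fin n → Fin n → DLinks n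
delete F u v x y with x Data.Fin.≟ u | y Data.Fin.≟ v
... | Relation.Nullary.yes _ | Relation.Nullary.yes _ = false
... | _ | _ = F x y

replace : {n : ℕ} → DLinks n → Fin n → Fin n → Fin n → DLinks n
replace F u v s x y with x Data.Fin.≟ s | y Data.Fin.≟ v
... | Relation.Nullary.yes _ | Relation.Nullary.yes _ = true
... | _ | _ = delete F u v x y

NonShortenable : {n : ℕ} → (r ea eb : Fin n) → DLinks n → Set
NonShortenable r ea eb F =
  Feasible r F ×
  (∀ u v → F u v ≡ true → ¬ Feasible r (delete F u v)) ×
  (∀ u v s → F u v ≡ true → IsShortening ea eb u v s v → s ≢ u →
     ¬ Feasible r (replace F u v s))

data Walk {n : ℕ} (F : DLinks n) : Fin n → Fin n → ℕ → Set where
  here : ∀ {x} → Walk F x x 0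
  step : ∀ {x y z k} → F x y ≡ true → Walk F y z k → Walk F x z (suc k)

Ancestor : {n : ℕ} → DLinks n → Fin n → Fin n → Set
Ancestor F a x = ∃[ k ] Walk F a x k

Dist : {n : ℕ} → DLinks n → Fin n → Fin n → ℕ → Set
Dist F x y k = Walk F x y k × (∀ k' → Walk F x y k' → k ≤ k')

OnRootPath : {n : ℕ} → Fin n → DLinks n → Fin n → Fin n → Fin n → Set
OnRootPath r F u a b = Ancestor F r a × (F a b ≡ true) × Ancestor F b u

Responsible : {n : ℕ} → Fin n → DLinks n → Fin n → Fin n → VSet n → Set
Responsible r F u v C =
  (F u v ≡ true) × Covers u v C ×
  (∀ a b → OnRootPath r F u a b → ¬ Covers a b C)

CutNonEmpty : {n : ℕ} → ULinks n → VSet n → Set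
CutNonEmpty K C = ∃[ x ] ∃[ y ] (K x y ≡ true × (C x ≡ true) × (C y ≡ false))

InDrop : {n : ℕ} → Fin n → DLinks n → ULinks n → Fin n → Fin n → Set
InDrop r F K u v =
  (F u v ≡ true) ×
  (∀ C → InCG r C → Responsible r F u v C → CutNonEmpty K C)

Cross : {n : ℕ} → Fin n → Fin n → Fin n → Fin n → Set
Cross a b c d =
  (a ≢ c) × (a ≢ d) × (b ≢ c) × (b ≢ d) ×
  -- path P1 of G from a to b (forward), path P2 from b to a (forward)
  ((fwd a c ≤ fwd a b) ⊎ (fwd a d ≤ fwd a b)) ×
  ((fwd b c ≤ fwd b a) ⊎ (fwd b d ≤ fwd b a))

Intersect : {n : ℕ} → Fin n → Fin n → Fin n → Fin n → Set
Intersect a b c d =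
  ((a ≡ c) ⊎ (a ≡ d) ⊎ (b ≡ c) ⊎ (b ≡ d)) ⊎ Cross a b c d

data HWalk {n : ℕ} (S : ULinks n) : Fin n → Fin n → Fin n → Fin n → Set where
  hhere : ∀ {a b} → HWalk S a b a b
  hstep : ∀ {a b c d e f} → S c d ≡ true → Intersect a b c d →
          HWalk S c d e f → HWalk S a b e f

HConnected : {n : ℕ} → ULinks n → Set
HConnected {n} S =
  (∃[ a ] ∃[ b ] (S a b ≡ true)) ×
  (∀ a b c d → S a b ≡ true → S c d ≡ true → HWalk S a b c d)

InVS : {n : ℕ} → ULinks n → Fin n → Set
InVS S x = ∃[ y ] (S x y ≡ true ⊎ S y x ≡ true)

IsLCA : {n : ℕ} → Fin n → DLinks n → (Fin n → Set) → Fin n → Set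
IsLCA r F U w =
  (∀ x → U x → Ancestor F w x) ×
  (∃[ k ] (Dist F r w k ×
     (∀ w' k' → (∀ x → U x → Ancestor F w' x) → Dist F r w' k' → k' ≤ k)))

InRHS : {n : ℕ} → DLinks n → ULinks n → Fin n → Fin n → Fin n → Set
InRHS F S w u v =
  (∃[ x ] (InVS S x × F u v ≡ true × v ≡ x)) × ¬ (F u v ≡ true × v ≡ w)

{-# OPTIONS --safe #-}
-- With r an end of the path G - e_r, the cuts in 𝒞_G are exactly the nonempty intervals of the
-- path that avoid r.  Non-shortenability gives every link (u , v) of F a witness cut, covered by
-- (u , v) alone and containing the inside of its span; comparing overlapping witness cuts shows
-- that (V , F) is an arborescence rooted at r in which every subtree is an interval, and that a
-- cut for which (u , v) is responsible lies entirely below v.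
--
-- If (u , v) ∈ Drop(S), the cut {v} must be left by a link of S, so v ∈ V(S); the subtree of v is
-- a cut for which (u , v) is responsible, so it is left by a link of S too, which rules out
-- v = lca(V(S)) since that subtree would contain V(S).  Conversely, let v ∈ V(S) ∖ {lca(V(S))}
-- and let C be a cut for which (u , v) is responsible.  An interval containing both endpoints of a
-- link contains an endpoint of every link intersecting it, so if no link of S left C, the
-- connectivity of H[S] would put V(S) inside C, hence below v, and v would be a deeper common
-- ancestor of V(S) than lca(V(S)).

module Submission where

open import Defs
open import Data.Nat using (ℕ; _≤_)
open import Data.Fin using (Fin)
open import Data.Bool using (true)
open import Data.Sum using (_⊎_)
open import Data.Product using (_×_)
open import Relation.Binary.PropositionalEquality using (_≡_)
open import Function.Bundles using (_⇔_)

open import Data.Nat.Properties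
open import Algebra.Properties.CommutativeMonoid.Sum +-0-commutativeMonoid using (sum-remove; sum-cong-≗; sum-replicate-zero) renaming (sum to ∑)
open import Data.Bool using (Bool; false; not; _∧_; _∨_; _xor_; T; if_then_else_)
open import Data.Bool.Properties using (¬-not; not-¬; ∨-zeroʳ; ∨-conicalˡ; ∨-conicalʳ) renaming (_≟_ to _≟ᵇ_)
open import Data.Empty using (⊥; ⊥-elim)
open import Data.Fin using (zero; suc; toℕ; fromℕ<; punchIn; punchOut)
open import Data.Fin.Properties using (toℕ-injective; toℕ<n; toℕ-fromℕ<; any?; punchIn-punchOut; punchInᵢ≢i; punchIn-injective; punchOut-injective) renaming (_≟_ to _≟ᶠ_)
open import Data.List using (map; allFin; tabulate)
open import Data.List.Properties using (map-tabulate)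
open import Data.Nat using (zero; suc; pred; _+_; _∸_; _<_; z≤n; s≤s; z<s; _≤?_; _<?_; _≤ᵇ_)
open import Data.Nat.Induction using (<-rec)
open import Data.Nat.ListAction using (sum)
open import Data.Nat.Solver using (module +-*-Solver)
open import Data.Product using (Σ; ∃-syntax; _,_; proj₁; proj₂)
open import Data.Sum using (inj₁; inj₂; [_,_]′)
open import Function using (_∘_)
open import Function.Bundles using (mk⇔; module Equivalence)
open import Relation.Binary.Definitions using (tri<; tri≈; tri>)
open import Relation.Binary.PropositionalEquality using (_≢_; refl; sym; trans; cong; cong₂; subst; subst₂; module ≡-Reasoning)
open import Relation.Nullary using (¬_; Dec; yes; no)
open import Relation.Nullary.Decidable using (isYes; decidable-stable; ¬¬-excluded-middle; _×-dec_; _⊎-dec_)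
open import Relation.Nullary.Negation using (¬¬-map)
open +-*-Solver using (solve; _:+_; _:=_)

-- Classical reasoning under double negation

¬¬-true : {b : Bool} → ¬ ¬ (b ≡ true) → b ≡ true
¬¬-true = decidable-stable (_ ≟ᵇ true)

¬¬-∀ : ∀ {k} (P : Fin k → Set) → (∀ x → ¬ ¬ P x) → ¬ ¬ (∀ x → P x)
¬¬-∀ {zero} P h k = k (λ ())
¬¬-∀ {suc k} P h k∀ = h zero λ p₀ → ¬¬-∀ (P ∘ suc) (h ∘ suc) λ pₛ →
  k∀ λ { zero → p₀ ; (suc x) → pₛ x }

¬¬-→ : {A B : Set} → (A → ¬ ¬ B) → ¬ ¬ (A → B)
¬¬-→ f k = k (λ a → ⊥-elim (f a (λ b → k (λ _ → b))))

¬¬-characteristic : ∀ {k} (P : Fin k → Set) →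
  ¬ ¬ (Σ (Fin k → Bool) λ χ → ∀ x → χ x ≡ true ⇔ P x)
¬¬-characteristic {zero} P k = k ((λ ()) , λ ())
¬¬-characteristic {suc k} P k∃ = ¬¬-excluded-middle {A = P zero} λ P₀? →
  ¬¬-characteristic (P ∘ suc) λ { (χ , spec) → k∃ (extend P₀? χ spec) }
  where
  extend : Dec (P zero) → (χ : Fin k → Bool) → (∀ x → χ x ≡ true ⇔ P (suc x)) →
           Σ (Fin (suc k) → Bool) λ χ′ → ∀ x → χ′ x ≡ true ⇔ P x
  extend (yes p₀) χ spec = (λ { zero → true ; (suc x) → χ x }) ,
    λ { zero → mk⇔ (λ _ → p₀) (λ _ → refl) ; (suc x) → spec x }
  extend (no ¬p₀) χ spec = (λ { zero → false ; (suc x) → χ x }) ,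
    λ { zero → mk⇔ (λ ()) (λ p₀ → ⊥-elim (¬p₀ p₀)) ; (suc x) → spec x }

¬¬-least : (P : ℕ → Set) → ∀ k → P k → ¬ ¬ (Σ ℕ λ j → P j × (∀ i → P i → j ≤ i))
¬¬-least P = <-rec _ λ k rec Pk done → ¬¬-excluded-middle {A = Σ ℕ λ i → P i × i < k} λ
  { (yes (i , Pi , i<k)) → rec i<k Pi done
  ; (no ¬smaller) → done (k , Pk , λ i Pi → ≮⇒≥ (λ i<k → ¬smaller (i , Pi , i<k))) }

¬¬-greatest : (P : ℕ → Set) → ∀ B → (∀ i → P i → i ≤ B) → ∀ k → P k →
              ¬ ¬ (Σ ℕ λ j → P j × (∀ i → P i → i ≤ j))
¬¬-greatest P B bounded k Pk = ¬¬-map greatest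
  (¬¬-least (λ d → P (B ∸ d)) (B ∸ k) (subst P (sym (m∸[m∸n]≡n (bounded k Pk))) Pk))
  where
  greatest : (Σ ℕ λ d → P (B ∸ d) × (∀ i → P (B ∸ i) → d ≤ i)) → Σ ℕ λ j → P j × (∀ i → P i → i ≤ j)
  greatest (d , Pd , least) = B ∸ d , Pd , λ i Pi → begin
    i             ≡⟨ sym (m∸[m∸n]≡n (bounded i Pi)) ⟩
    B ∸ (B ∸ i)   ≤⟨ ∸-monoʳ-≤ B (least (B ∸ i) (subst P (sym (m∸[m∸n]≡n (bounded i Pi))) Pi)) ⟩
    B ∸ d         ∎
    where open ≤-Reasoning

colour-change : (D : ℕ → Bool) (β : Bool) → ∀ {i j} → i ≤ j → D i ≡ β → D j ≡ not β →
                Σ ℕ λ k → i ≤ k × k < j × D k ≡ β × D (suc k) ≡ not β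
colour-change D β {i} {zero} i≤j Di Dj with n≤0⇒n≡0 i≤j
... | refl = ⊥-elim (not-¬ refl (trans (sym Di) Dj))
colour-change D β {i} {suc j} i≤j Di Dj with m≤n⇒m<n∨m≡n i≤j
... | inj₂ refl = ⊥-elim (not-¬ refl (trans (sym Di) Dj))
... | inj₁ i<1+j with D j ≟ᵇ β
...   | yes Dj′ = j , ≤-pred i<1+j , ≤-refl , Dj′ , Dj
...   | no Dj′ with colour-change D β (≤-pred i<1+j) Di (¬-not Dj′)
...     | k , i≤k , k<j , Dk , Dk+1 = k , i≤k , m<n⇒m<1+n k<j , Dk , Dk+1

∑-allFin : ∀ {k} (f : Fin k → ℕ) → sum (map f (allFin k)) ≡ ∑ f
∑-allFin {k} f = trans (cong sum (map-tabulate (λ x → x) f)) (sum-tabulate f)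
  where
  sum-tabulate : ∀ {k} (g : Fin k → ℕ) → sum (tabulate g) ≡ ∑ g
  sum-tabulate {zero} g = refl
  sum-tabulate {suc k} g = cong (g zero +_) (sum-tabulate (g ∘ suc))

∑-zero : ∀ {k} (f : Fin k → ℕ) → (∀ x → f x ≡ 0) → ∑ f ≡ 0
∑-zero {k} f f≡0 = trans (sum-cong-≗ f≡0) (sum-replicate-zero k)

∑-single : ∀ {k} (f : Fin k → ℕ) a → (∀ x → x ≢ a → f x ≡ 0) → ∑ f ≡ f a
∑-single {suc k} f a rest≡0 = begin
  ∑ f                             ≡⟨ sum-remove {i = a} f ⟩
  f a + ∑ (f ∘ punchIn a)         ≡⟨ cong (f a +_) (∑-zero _ (λ x → rest≡0 _ (punchInᵢ≢i a x))) ⟩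
  f a + 0                         ≡⟨ +-identityʳ (f a) ⟩
  f a                             ∎
  where open ≡-Reasoning

∑-pair : ∀ {k} (f : Fin k → ℕ) {a b} → a ≢ b → (∀ x → x ≢ a → x ≢ b → f x ≡ 0) →
         ∑ f ≡ f a + f b
∑-pair {suc k} f {a} {b} a≢b rest≡0 = begin
  ∑ f                      ≡⟨ sum-remove {i = a} f ⟩
  f a + ∑ (f ∘ punchIn a)  ≡⟨ cong (f a +_) (∑-single _ b′ rest′≡0) ⟩
  f a + f (punchIn a b′)   ≡⟨ cong (λ x → f a + f x) (punchIn-punchOut a≢b) ⟩
  f a + f b                ∎
  where
  open ≡-Reasoning
  b′ : Fin k
  b′ = punchOut a≢b
  rest′≡0 : ∀ x → x ≢ b′ → f (punchIn a x) ≡ 0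
  rest′≡0 x x≢b′ = rest≡0 _ (punchInᵢ≢i a x) λ x≡b →
    x≢b′ (punchIn-injective a x b′ (trans x≡b (sym (punchIn-punchOut a≢b))))

∑-point-≤ : ∀ {k} (f : Fin k → ℕ) a → f a ≤ ∑ f
∑-point-≤ {suc k} f a = subst (f a ≤_) (sym (sum-remove {i = a} f)) (m≤m+n (f a) _)

∑-pair-≤ : ∀ {k} (f : Fin k → ℕ) {a b} → a ≢ b → f a + f b ≤ ∑ f
∑-pair-≤ {suc k} f {a} {b} a≢b = begin
  f a + f b                     ≡⟨ cong (λ x → f a + f x) (sym (punchIn-punchOut a≢b)) ⟩
  f a + f (punchIn a b′)        ≤⟨ +-monoʳ-≤ (f a) (∑-point-≤ (f ∘ punchIn a) b′) ⟩
  f a + ∑ (f ∘ punchIn a)       ≡⟨ sym (sum-remove {i = a} f) ⟩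
  ∑ f                           ∎
  where
  open ≤-Reasoning
  b′ : Fin k
  b′ = punchOut a≢b

∑-triple-≤ : ∀ {k} (f : Fin k → ℕ) {a b c} → a ≢ b → a ≢ c → b ≢ c → f a + (f b + f c) ≤ ∑ f
∑-triple-≤ {suc k} f {a} {b} {c} a≢b a≢c b≢c = begin
  f a + (f b + f c)
    ≡⟨ cong₂ (λ x y → f a + (f x + f y)) (sym (punchIn-punchOut a≢b)) (sym (punchIn-punchOut a≢c)) ⟩
  f a + (f (punchIn a b′) + f (punchIn a c′))
    ≤⟨ +-monoʳ-≤ (f a) (∑-pair-≤ (f ∘ punchIn a) (b≢c ∘ punchOut-injective a≢b a≢c)) ⟩
  f a + ∑ (f ∘ punchIn a)
    ≡⟨ sym (sum-remove {i = a} f) ⟩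
  ∑ f
    ∎
  where
  open ≤-Reasoning
  b′ c′ : Fin k
  b′ = punchOut a≢b
  c′ = punchOut a≢c

-- a + b ≡ c modulo n, for a, b, c < n (so the sum wraps around at most once)
AddMod : ℕ → ℕ → ℕ → ℕ → Set
AddMod n a b c = (a + b ≡ c) ⊎ (a + b ≡ n + c)

fwd-addMod : ∀ {n} (x y : Fin n) → fwd x y < n × AddMod n (fwd x y) (toℕ x) (toℕ y)
fwd-addMod {n} x y = spec (toℕ x) (toℕ y) (toℕ<n x) (toℕ<n y)
  where
  spec : ∀ X Y → X < n → Y < n →
         (if X ≤ᵇ Y then Y ∸ X else (n + Y) ∸ X) < n ×
         AddMod n (if X ≤ᵇ Y then Y ∸ X else (n + Y) ∸ X) X Y
  spec X Y X<n Y<n with X ≤ᵇ Y in X≤ᵇY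
  ... | true = ≤-<-trans (m∸n≤m Y X) Y<n , inj₁ (m∸n+n≡m X≤Y)
    where
    X≤Y : X ≤ Y
    X≤Y = ≤ᵇ⇒≤ X Y (subst T (sym X≤ᵇY) _)
  ... | false = wrapped<n , inj₂ (m∸n+n≡m X≤n+Y)
    where
    Y<X : Y < X
    Y<X = ≰⇒> λ X≤Y → subst T X≤ᵇY (≤⇒≤ᵇ X≤Y)
    X≤n+Y : X ≤ n + Y
    X≤n+Y = ≤-trans (<⇒≤ X<n) (m≤m+n n Y)
    wrapped<n : (n + Y) ∸ X < n
    wrapped<n = +-cancelʳ-< X _ n (subst (_< n + X) (sym (m∸n+n≡m X≤n+Y)) (+-monoʳ-< n Y<X))

private
  cross-cancel : ∀ a b e k l Y → a + e ≡ k + Y → b + e ≡ l + Y → a + l ≡ b + k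
  cross-cancel a b e k l Y p q = +-cancelʳ-≡ e (a + l) (b + k) (begin
    a + l + e    ≡⟨ solve 3 (λ a l e → a :+ l :+ e := (a :+ e) :+ l) refl a l e ⟩
    (a + e) + l  ≡⟨ cong (_+ l) p ⟩
    (k + Y) + l  ≡⟨ solve 3 (λ k Y l → (k :+ Y) :+ l := (l :+ Y) :+ k) refl k Y l ⟩
    (l + Y) + k  ≡⟨ cong (_+ k) (sym q) ⟩
    (b + e) + k  ≡⟨ solve 3 (λ b e k → (b :+ e) :+ k := b :+ k :+ e) refl b e k ⟩
    b + k + e    ∎)
    where open ≡-Reasoning

  cancel-mod : ∀ n {A q e Y} → A < n + n → q < n →
           (A + e ≡ Y ⊎ A + e ≡ n + Y ⊎ A + e ≡ (n + n) + Y) → AddMod n q e Y →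
           (A ≡ q) ⊎ (A ≡ n + q)
  cancel-mod n {A} {q} {e} {Y} A<2n q<n (inj₁ p) (inj₁ r) = inj₁ (+-cancelʳ-≡ e A q (trans p (sym r)))
  cancel-mod n {A} {q} {e} {Y} A<2n q<n (inj₁ p) (inj₂ r) =
    ⊥-elim (m+n≮n A n (subst (_< n) (sym (trans (cross-cancel A q e 0 n Y p r) (+-identityʳ q))) q<n))
  cancel-mod n {A} {q} {e} {Y} A<2n q<n (inj₂ (inj₁ p)) (inj₁ r) =
    inj₂ (trans (sym (+-identityʳ A)) (trans (cross-cancel A q e n 0 Y p r) (+-comm q n)))
  cancel-mod n {A} {q} {e} {Y} A<2n q<n (inj₂ (inj₁ p)) (inj₂ r) = inj₁ (+-cancelʳ-≡ e A q (trans p (sym r)))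
  cancel-mod n {A} {q} {e} {Y} A<2n q<n (inj₂ (inj₂ p)) (inj₁ r) =
    ⊥-elim (m+n≮n q (n + n) (subst (_< n + n) (trans (sym (+-identityʳ A)) (cross-cancel A q e (n + n) 0 Y p r)) A<2n))
  cancel-mod n {A} {q} {e} {Y} A<2n q<n (inj₂ (inj₂ p)) (inj₂ r) =
    inj₂ (+-cancelʳ-≡ n A (n + q) (trans (cross-cancel A q e (n + n) n Y p r)
      (solve 2 (λ q n → q :+ (n :+ n) := n :+ q :+ n) refl q n)))

addMod-compose : ∀ {n d a c e X Y} → d < n → a < n → c < n →
  AddMod n d X Y → AddMod n a e X → AddMod n c e Y → AddMod n d a c
addMod-compose {n} {d} {a} {c} {e} {X} {Y} d<n a<n c<n dXY aeX = cancel-mod n (+-mono-< d<n a<n) c<n (excess dXY aeX)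
  where
  excess : AddMod n d X Y → AddMod n a e X →
           d + a + e ≡ Y ⊎ d + a + e ≡ n + Y ⊎ d + a + e ≡ (n + n) + Y
  excess (inj₁ p) (inj₁ q) = inj₁ (trans (+-assoc d a e) (trans (cong (d +_) q) p))
  excess (inj₂ p) (inj₁ q) = inj₂ (inj₁ (trans (+-assoc d a e) (trans (cong (d +_) q) p)))
  excess (inj₁ p) (inj₂ q) = inj₂ (inj₁ (trans (+-assoc d a e) (trans (cong (d +_) q)
    (trans (solve 3 (λ d n X → d :+ (n :+ X) := n :+ (d :+ X)) refl d n X) (cong (n +_) p)))))
  excess (inj₂ p) (inj₂ q) = inj₂ (inj₂ (trans (+-assoc d a e) (trans (cong (d +_) q)
    (trans (solve 3 (λ d n X → d :+ (n :+ X) := n :+ (d :+ X)) refl d n X)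
      (trans (cong (n +_) p) (sym (+-assoc n n Y)))))))

addMod-unique : ∀ {n a a′ e X} → a < n → a′ < n → AddMod n a e X → AddMod n a′ e X → a ≡ a′
addMod-unique {n} a<n a′<n aeX a′eX with cancel-mod n (<-≤-trans a<n (m≤m+n n n)) a′<n ([ inj₁ , inj₂ ∘ inj₁ ]′ aeX) a′eX
... | inj₁ a≡a′ = a≡a′
... | inj₂ a≡n+a′ = ⊥-elim (<⇒≱ a<n (≤-trans (m≤m+n n _) (≤-reflexive (sym a≡n+a′))))

Between : ℕ → ℕ → ℕ → Set
Between a y c = (a ≤ y × y ≤ c) ⊎ (c ≤ y × y ≤ a)

StrictlyBetween : ℕ → ℕ → ℕ → Set
StrictlyBetween a y c = (a < y × y < c) ⊎ (c < y × y < a)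

between? : ∀ a y c → Dec (Between a y c)
between? a y c = (a ≤? y ×-dec y ≤? c) ⊎-dec (c ≤? y ×-dec y ≤? a)

strictlyBetween? : ∀ a y c → Dec (StrictlyBetween a y c)
strictlyBetween? a y c = (a <? y ×-dec y <? c) ⊎-dec (c <? y ×-dec y <? a)

between-sym : ∀ {a y c} → Between a y c → Between c y a
between-sym = [ inj₂ , inj₁ ]′

strictlyBetween-sym : ∀ {a y c} → StrictlyBetween a y c → StrictlyBetween c y a
strictlyBetween-sym = [ inj₂ , inj₁ ]′

strictly⇒between : ∀ {a y c} → StrictlyBetween a y c → Between a y c
strictly⇒between (inj₁ (p , q)) = inj₁ (<⇒≤ p , <⇒≤ q)
strictly⇒between (inj₂ (p , q)) = inj₂ (<⇒≤ p , <⇒≤ q)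

between∧≢⇒strictly : ∀ {a y c} → Between a y c → y ≢ a → y ≢ c → StrictlyBetween a y c
between∧≢⇒strictly (inj₁ (p , q)) y≢a y≢c = inj₁ (≤∧≢⇒< p (y≢a ∘ sym) , ≤∧≢⇒< q y≢c)
between∧≢⇒strictly (inj₂ (p , q)) y≢a y≢c = inj₂ (≤∧≢⇒< p (y≢c ∘ sym) , ≤∧≢⇒< q y≢a)

between-same : ∀ {a y} → Between a y a → y ≡ a
between-same (inj₁ (p , q)) = ≤-antisym q p
between-same (inj₂ (p , q)) = ≤-antisym q p

between-left : ∀ a c → Between a a c
between-left a c with ≤-total a c
... | inj₁ a≤c = inj₁ (≤-refl , a≤c)
... | inj₂ c≤a = inj₂ (c≤a , ≤-refl)

between-right : ∀ a c → Between a c c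
between-right a c = between-sym (between-left c a)

strictlyBetween-≢ˡ : ∀ {a y c} → StrictlyBetween a y c → y ≢ a
strictlyBetween-≢ˡ (inj₁ (p , q)) refl = <-irrefl refl p
strictlyBetween-≢ˡ (inj₂ (p , q)) refl = <-irrefl refl q

strictlyBetween-≢ʳ : ∀ {a y c} → StrictlyBetween a y c → y ≢ c
strictlyBetween-≢ʳ s = strictlyBetween-≢ˡ (strictlyBetween-sym s)

between-split : ∀ {x y z} m → Between x y z → Between x y m ⊎ Between m y z
between-split {y = y} m (inj₁ (p , q)) with ≤-total y m
... | inj₁ y≤m = inj₁ (inj₁ (p , y≤m))
... | inj₂ m≤y = inj₂ (inj₁ (m≤y , q))
between-split {y = y} m (inj₂ (p , q)) with ≤-total y m
... | inj₁ y≤m = inj₂ (inj₂ (p , y≤m))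
... | inj₂ m≤y = inj₁ (inj₂ (m≤y , q))

between-towards : ∀ {y₁ y y₂ x z} → Between y₁ y y₂ → Between x z y → Between x z y₁ ⊎ Between x z y₂
between-towards (inj₁ (_ , q)) (inj₁ (c , d)) = inj₂ (inj₁ (c , ≤-trans d q))
between-towards (inj₂ (_ , q)) (inj₁ (c , d)) = inj₁ (inj₁ (c , ≤-trans d q))
between-towards (inj₁ (p , _)) (inj₂ (c , d)) = inj₁ (inj₂ (≤-trans p c , d))
between-towards (inj₂ (p , _)) (inj₂ (c , d)) = inj₂ (inj₂ (≤-trans p c , d))

between-beyond : ∀ {x z p y} → Between x z p → ¬ Between x z y → z ≢ p → StrictlyBetween p z y
between-beyond {z = z} {y = y} (inj₁ (a , b)) ¬xzy z≢p with ≤-total z y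
... | inj₁ z≤y = ⊥-elim (¬xzy (inj₁ (a , z≤y)))
... | inj₂ y≤z = inj₂ (≤∧≢⇒< y≤z (λ e → ¬xzy (inj₁ (a , ≤-reflexive (sym e)))) , ≤∧≢⇒< b z≢p)
between-beyond {z = z} {y = y} (inj₂ (a , b)) ¬xzy z≢p with ≤-total y z
... | inj₁ y≤z = ⊥-elim (¬xzy (inj₂ (y≤z , b)))
... | inj₂ z≤y = inj₁ (≤∧≢⇒< a (z≢p ∘ sym) , ≤∧≢⇒< z≤y (λ e → ¬xzy (inj₂ (≤-reflexive (sym e) , b))))

between-first-step : ∀ {s y t} s′ → Between s y t → y ≡ s ⊎ StrictlyBetween s y s′ ⊎ Between s′ y t
between-first-step {s} {y} s′ (inj₁ (a , b)) with <-cmp s y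
... | tri≈ _ e _ = inj₁ (sym e)
... | tri> _ _ c = ⊥-elim (<⇒≱ c a)
... | tri< c _ _ with <-cmp y s′
...   | tri< d _ _ = inj₂ (inj₁ (inj₁ (c , d)))
...   | tri≈ _ d _ = inj₂ (inj₂ (inj₁ (≤-reflexive (sym d) , b)))
...   | tri> _ _ d = inj₂ (inj₂ (inj₁ (<⇒≤ d , b)))
between-first-step {s} {y} s′ (inj₂ (a , b)) with <-cmp y s
... | tri≈ _ e _ = inj₁ e
... | tri> _ _ c = ⊥-elim (<⇒≱ c b)
... | tri< c _ _ with <-cmp s′ y
...   | tri< d _ _ = inj₂ (inj₁ (inj₂ (d , c)))
...   | tri≈ _ d _ = inj₂ (inj₂ (inj₂ (a , ≤-reflexive (sym d))))
...   | tri> _ _ d = inj₂ (inj₂ (inj₂ (a , <⇒≤ d)))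

between-shrink : ∀ {u z t} v → Between u z t → ¬ Between v z t → Between u z v
between-shrink {z = z} v (inj₁ (a , b)) ¬vzt with ≤-total v z
... | inj₁ v≤z = ⊥-elim (¬vzt (inj₁ (v≤z , b)))
... | inj₂ z≤v = inj₁ (a , z≤v)
between-shrink {z = z} v (inj₂ (a , b)) ¬vzt with ≤-total z v
... | inj₁ z≤v = ⊥-elim (¬vzt (inj₂ (a , z≤v)))
... | inj₂ v≤z = inj₂ (v≤z , b)

¬between : ∀ {x₁ y x₂} → ¬ Between x₁ y x₂ → Between y x₁ x₂ ⊎ Between y x₂ x₁
¬between {x₁} {y} {x₂} ¬x₁yx₂ with ≤-total x₁ x₂ | ≤-total y x₁ | ≤-total y x₂
... | inj₁ a | inj₁ b | _ = inj₁ (inj₁ (b , a))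
... | inj₁ a | inj₂ b | inj₁ c = ⊥-elim (¬x₁yx₂ (inj₁ (b , c)))
... | inj₁ a | inj₂ b | inj₂ c = inj₂ (inj₂ (a , c))
... | inj₂ a | _ | inj₁ c = inj₂ (inj₁ (c , a))
... | inj₂ a | inj₁ b | inj₂ c = ⊥-elim (¬x₁yx₂ (inj₂ (c , b)))
... | inj₂ a | inj₂ b | inj₂ c = inj₁ (inj₂ (a , b))

¬strictlyBetween : ∀ {a p c z} → ¬ StrictlyBetween a p c → p ≢ a → p ≢ c →
                   StrictlyBetween a z c → StrictlyBetween p a z ⊎ StrictlyBetween z c p
¬strictlyBetween {a} {p} {c} ¬apc p≢a p≢c (inj₁ (az , zc)) with <-cmp p a | <-cmp p c
... | tri< pa _ _ | _ = inj₁ (inj₁ (pa , az))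
... | tri≈ _ e _ | _ = ⊥-elim (p≢a e)
... | tri> _ _ ap | tri< pc _ _ = ⊥-elim (¬apc (inj₁ (ap , pc)))
... | tri> _ _ ap | tri≈ _ e _ = ⊥-elim (p≢c e)
... | tri> _ _ ap | tri> _ _ cp = inj₂ (inj₁ (zc , cp))
¬strictlyBetween {a} {p} {c} ¬apc p≢a p≢c (inj₂ (cz , za)) with <-cmp p a | <-cmp p c
... | tri> _ _ ap | _ = inj₁ (inj₂ (za , ap))
... | tri≈ _ e _ | _ = ⊥-elim (p≢a e)
... | tri< pa _ _ | tri> _ _ cp = ⊥-elim (¬apc (inj₂ (cp , pa)))
... | tri< pa _ _ | tri≈ _ e _ = ⊥-elim (p≢c e)
... | tri< pa _ _ | tri< pc _ _ = inj₂ (inj₂ (pc , cz))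

fwd≡0⇒≡ : ∀ {n} (x y : Fin n) → fwd x y ≡ 0 → x ≡ y
fwd≡0⇒≡ {n} x y fwd≡0 with proj₂ (fwd-addMod x y)
... | inj₁ p = toℕ-injective (trans (sym (cong (_+ toℕ x) fwd≡0)) p)
... | inj₂ p = ⊥-elim (<⇒≱ (toℕ<n x) (≤-trans (m≤m+n n (toℕ y)) (≤-reflexive (sym (trans (sym (cong (_+ toℕ x) fwd≡0)) p)))))

module Position {n : ℕ} (b : Fin n) where

  pos : Fin n → ℕ
  pos = fwd b

  pos<n : ∀ x → pos x < n
  pos<n x = proj₁ (fwd-addMod b x)

  fwd<n : ∀ x y → fwd x y < n
  fwd<n x y = proj₁ (fwd-addMod x y)

  fwd-pos : ∀ x y → AddMod n (fwd x y) (pos x) (pos y)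
  fwd-pos x y = addMod-compose (fwd<n x y) (pos<n x) (pos<n y)
    (proj₂ (fwd-addMod x y)) (proj₂ (fwd-addMod b x)) (proj₂ (fwd-addMod b y))

  pos-injective : ∀ {x y} → pos x ≡ pos y → x ≡ y
  pos-injective {x} {y} px≡py with fwd-pos x y
  ... | inj₁ p = fwd≡0⇒≡ x y (+-cancelʳ-≡ (pos x) (fwd x y) 0 (trans p (sym px≡py)))
  ... | inj₂ p = ⊥-elim (<-irrefl p (subst (λ t → fwd x y + pos x < n + t) px≡py (+-monoˡ-< (pos x) (fwd<n x y))))

  pos-base : pos b ≡ 0
  pos-base = addMod-unique (pos<n b) (≤-<-trans z≤n (pos<n b)) (proj₂ (fwd-addMod b b)) (inj₁ refl)

  edge⇒pos-suc : ∀ x y → fwd x y ≡ 1 → (pos y ≡ suc (pos x)) ⊎ (suc (pos x) ≡ n × pos y ≡ 0)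
  edge⇒pos-suc x y edge with fwd-pos x y
  ... | inj₁ p = inj₁ (trans (sym p) (cong (_+ pos x) edge))
  ... | inj₂ p = inj₂ (≤-antisym (pos<n x) n≤1+px , py≡0)
    where
    1+px≡n+py : suc (pos x) ≡ n + pos y
    1+px≡n+py = trans (sym (cong (_+ pos x) edge)) p
    n≤1+px : n ≤ suc (pos x)
    n≤1+px = ≤-trans (m≤m+n n (pos y)) (≤-reflexive (sym 1+px≡n+py))
    py≡0 : pos y ≡ 0
    py≡0 = n≤0⇒n≡0 (+-cancelˡ-≤ n (pos y) 0
             (≤-trans (≤-reflexive (sym 1+px≡n+py)) (≤-trans (pos<n x) (≤-reflexive (sym (+-identityʳ n))))))

  pos-suc⇒edge : ∀ {x y} → pos y ≡ suc (pos x) → fwd x y ≡ 1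
  pos-suc⇒edge {x} {y} py≡1+px with fwd-pos x y
  ... | inj₁ p = +-cancelʳ-≡ (pos x) (fwd x y) 1 (trans p py≡1+px)
  ... | inj₂ p = ⊥-elim (<⇒≱ (fwd<n x y) (+-cancelʳ-≤ (pos x) n (fwd x y)
                   (≤-trans (n≤1+n _) (≤-reflexive (sym (trans p (trans (cong (n +_) py≡1+px) (+-suc n (pos x)))))))))

  pos-wrap⇒edge : 2 ≤ n → ∀ {x y} → suc (pos x) ≡ n → pos y ≡ 0 → fwd x y ≡ 1
  pos-wrap⇒edge 2≤n {x} {y} 1+px≡n py≡0 with fwd-pos x y
  ... | inj₁ p = ⊥-elim (<-irrefl refl (<-≤-trans 2≤n (≤-reflexive (trans (sym 1+px≡n) (cong suc px≡0)))))
    where px≡0 : pos x ≡ 0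
          px≡0 = n≤0⇒n≡0 (≤-trans (m≤n+m (pos x) (fwd x y)) (≤-reflexive (trans p py≡0)))
  ... | inj₂ p = +-cancelʳ-≡ (pos x) (fwd x y) 1 (trans p (trans (cong (n +_) py≡0) (trans (+-identityʳ n) (sym 1+px≡n))))

  arc-pos : ∀ {a c z} → pos a ≤ pos c → fwd a z ≤ fwd a c → pos a ≤ pos z × pos z ≤ pos c
  arc-pos {a} {c} {z} pa≤pc az≤ac with fwd-pos a c
  ... | inj₂ p = ⊥-elim (<⇒≱ (fwd<n a c) (+-cancelʳ-≤ (pos a) n (fwd a c)
                   (≤-trans (+-monoʳ-≤ n pa≤pc) (≤-reflexive (sym p)))))
  ... | inj₁ p with fwd-pos a z
  ...   | inj₁ q = ≤-trans (m≤n+m (pos a) (fwd a z)) (≤-reflexive q) ,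
                   ≤-trans (≤-reflexive (sym q)) (≤-trans (+-monoˡ-≤ (pos a) az≤ac) (≤-reflexive p))
  ...   | inj₂ q = ⊥-elim (<⇒≱ (pos<n c) (≤-trans (m≤m+n n (pos z))
                   (≤-trans (≤-reflexive (sym q)) (≤-trans (+-monoˡ-≤ (pos a) az≤ac) (≤-reflexive p)))))

  vertex-at : ∀ k → k < n → Σ (Fin n) λ x → pos x ≡ k
  vertex-at k k<n with toℕ b + k <? n
  ... | yes b+k<n = fromℕ< b+k<n , addMod-unique (pos<n _) k<n (proj₂ (fwd-addMod b _))
                      (inj₁ (trans (+-comm k (toℕ b)) (sym (toℕ-fromℕ< b+k<n))))
  ... | no b+k≮n = fromℕ< X<n , addMod-unique (pos<n _) k<n (proj₂ (fwd-addMod b _))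
                     (inj₂ (trans (+-comm k (toℕ b)) (sym (trans (cong (n +_) (toℕ-fromℕ< X<n)) (m+[n∸m]≡n n≤b+k)))))
    where
    n≤b+k : n ≤ toℕ b + k
    n≤b+k = ≮⇒≥ b+k≮n
    X<n : toℕ b + k ∸ n < n
    X<n = +-cancelʳ-< n _ n (subst (_< n + n) (sym (m∸n+n≡m n≤b+k)) (+-mono-< (toℕ<n b) k<n))

  step-toward : ∀ {u v t} → StrictlyBetween (pos u) (pos t) (pos v) →
    Σ (Fin n) λ s → StrictlyBetween (pos u) (pos s) (pos v) ×
      (∀ t′ → StrictlyBetween (pos u) (pos t′) (pos v) → Between (pos s) (pos t′) (pos v))
  step-toward {u} {v} {t} (inj₁ (u<t , t<v)) = s , inj₁ (subst (pos u <_) (sym ps) ≤-refl , subst (_< pos v) (sym ps) (≤-<-trans u<t t<v)) , beyond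
    where
    s : Fin n
    s = proj₁ (vertex-at (suc (pos u)) (≤-<-trans u<t (pos<n t)))
    ps : pos s ≡ suc (pos u)
    ps = proj₂ (vertex-at (suc (pos u)) (≤-<-trans u<t (pos<n t)))
    beyond : ∀ t′ → StrictlyBetween (pos u) (pos t′) (pos v) → Between (pos s) (pos t′) (pos v)
    beyond t′ (inj₁ (u<t′ , t′<v)) = inj₁ (subst (_≤ pos t′) (sym ps) u<t′ , <⇒≤ t′<v)
    beyond t′ (inj₂ (v<t′ , t′<u)) = ⊥-elim (<-asym (<-trans u<t t<v) (<-trans v<t′ t′<u))
  step-toward {u} {v} {t} (inj₂ (v<t , t<u)) =
    s , inj₂ (subst (pos v <_) (sym ps) (<-≤-trans v<t (<⇒≤pred t<u)) , subst (_< pos u) (sym ps) (pred< t<u)) , beyond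
    where
    pred< : ∀ {m k} → m < k → pred k < k
    pred< (s≤s _) = n<1+n _
    s : Fin n
    s = proj₁ (vertex-at (pred (pos u)) (<-trans (pred< t<u) (pos<n u)))
    ps : pos s ≡ pred (pos u)
    ps = proj₂ (vertex-at (pred (pos u)) (<-trans (pred< t<u) (pos<n u)))
    beyond : ∀ t′ → StrictlyBetween (pos u) (pos t′) (pos v) → Between (pos s) (pos t′) (pos v)
    beyond t′ (inj₂ (v<t′ , t′<u)) = inj₂ (<⇒≤ v<t′ , subst (pos t′ ≤_) (sym ps) (<⇒≤pred t′<u))
    beyond t′ (inj₁ (u<t′ , t′<v)) = ⊥-elim (<-asym (<-trans v<t t<u) (<-trans u<t′ t′<v))

  IsEnd : Fin n → Set
  IsEnd x = pos x ≡ 0 ⊎ suc (pos x) ≡ n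

  end-not-inside : ∀ {x} → IsEnd x → ∀ {a c} → ¬ StrictlyBetween (pos a) (pos x) (pos c)
  end-not-inside (inj₁ x≡0) (inj₁ (a<x , _)) = n≮0 (subst (_ <_) x≡0 a<x)
  end-not-inside (inj₁ x≡0) (inj₂ (c<x , _)) = n≮0 (subst (_ <_) x≡0 c<x)
  end-not-inside (inj₂ 1+x≡n) {c = c} (inj₁ (_ , x<c)) = <⇒≱ (pos<n c) (subst (_≤ pos c) 1+x≡n x<c)
  end-not-inside (inj₂ 1+x≡n) {a = a} (inj₂ (_ , x<a)) = <⇒≱ (pos<n a) (subst (_≤ pos a) 1+x≡n x<a)

  cut-edge-end : ∀ {a} → fwd a b ≡ 1 → ∀ {x} → a ≡ x ⊎ b ≡ x → IsEnd x
  cut-edge-end _ (inj₂ refl) = inj₁ pos-base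
  cut-edge-end {a} a→b (inj₁ refl) with edge⇒pos-suc a b a→b
  ... | inj₁ b≡1+a = ⊥-elim (0≢1+n (trans (sym pos-base) b≡1+a))
  ... | inj₂ (1+a≡n , _) = inj₂ 1+a≡n

  -- positions ≥ n are sent to the junk value b
  vertexAt : ℕ → Fin n
  vertexAt k with k <? n
  ... | yes k<n = proj₁ (vertex-at k k<n)
  ... | no _ = b

  pos-vertexAt : ∀ {k} → k < n → pos (vertexAt k) ≡ k
  pos-vertexAt {k} k<n with k <? n
  ... | yes k<n′ = proj₂ (vertex-at k k<n′)
  ... | no k≮n = ⊥-elim (k≮n k<n)

  vertexAt-pos : ∀ x → vertexAt (pos x) ≡ x
  vertexAt-pos x = pos-injective (pos-vertexAt (pos<n x))

  pos≢n : ∀ x → pos x ≢ n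
  pos≢n x px≡n = <-irrefl px≡n (pos<n x)

  successor-unique : ∀ x {y y′} → fwd x y ≡ 1 → fwd x y′ ≡ 1 → y ≡ y′
  successor-unique x {y} {y′} e e′ with edge⇒pos-suc x y e | edge⇒pos-suc x y′ e′
  ... | inj₁ p | inj₁ q = pos-injective (trans p (sym q))
  ... | inj₁ p | inj₂ (q , _) = ⊥-elim (pos≢n y (trans p q))
  ... | inj₂ (p , _) | inj₁ q = ⊥-elim (pos≢n y′ (trans q p))
  ... | inj₂ (_ , p) | inj₂ (_ , q) = pos-injective (trans p (sym q))

  predecessor-unique : ∀ {x x′} y → fwd x y ≡ 1 → fwd x′ y ≡ 1 → x ≡ x′
  predecessor-unique {x} {x′} y e e′ with edge⇒pos-suc x y e | edge⇒pos-suc x′ y e′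
  ... | inj₁ p | inj₁ q = pos-injective (suc-injective (trans (sym p) q))
  ... | inj₁ p | inj₂ (_ , q) = ⊥-elim (0≢1+n (trans (sym q) p))
  ... | inj₂ (_ , p) | inj₁ q = ⊥-elim (0≢1+n (trans (sym p) q))
  ... | inj₂ (p , _) | inj₂ (q , _) = pos-injective (suc-injective (trans p (sym q)))

  module _ (2≤n : 2 ≤ n) where

    successor : ∀ x → Σ (Fin n) λ y → fwd x y ≡ 1
    successor x with suc (pos x) <? n
    ... | yes 1+px<n = vertexAt (suc (pos x)) , pos-suc⇒edge (pos-vertexAt 1+px<n)
    ... | no 1+px≮n = vertexAt 0 , pos-wrap⇒edge 2≤n (≤-antisym (pos<n x) (≮⇒≥ 1+px≮n)) (pos-vertexAt (≤-trans (s≤s z≤n) 2≤n))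

    predecessor : ∀ y → Σ (Fin n) λ x → fwd x y ≡ 1
    predecessor y with pos y in py
    ... | zero = vertexAt (n ∸ 1) , pos-wrap⇒edge 2≤n (trans (cong suc (pos-vertexAt n∸1<n)) 1+[n∸1]≡n) py
      where
      1+[n∸1]≡n : suc (n ∸ 1) ≡ n
      1+[n∸1]≡n = trans (+-comm 1 (n ∸ 1)) (m∸n+n≡m (≤-trans (s≤s z≤n) 2≤n))
      n∸1<n : n ∸ 1 < n
      n∸1<n = ≤-reflexive 1+[n∸1]≡n
    ... | suc k = vertexAt k , pos-suc⇒edge (trans py (cong suc (sym (pos-vertexAt (≤-trans (n≤1+n _) (subst (_< n) py (pos<n y)))))))

∨≡true : ∀ a {c} → a ∨ c ≡ true → a ≡ true ⊎ c ≡ true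
∨≡true true _ = inj₁ refl
∨≡true false c≡true = inj₂ c≡true

-- Cuts of the cycle as intervals

module Cuts {n : ℕ} (2≤n : 2 ≤ n) (b r : Fin n) where
  open Position b

  Convex : VSet n → Set
  Convex C = ∀ x y z → C x ≡ true → C z ≡ true → Between (pos x) (pos y) (pos z) → C y ≡ true

  Interval : VSet n → Set
  Interval C = (C r ≡ false) × (∃[ x ] C x ≡ true) × Convex C

  cutEdge : VSet n → Fin n → Fin n → ℕ
  cutEdge C x y = if isEdgeᵇ x y ∧ (C x xor C y) then 1 else 0

  cutSize≡∑ : ∀ C → cutSize C ≡ ∑ (λ x → ∑ (cutEdge C x))
  cutSize≡∑ C = trans (∑-allFin {n} _) (sum-cong-≗ (λ x → ∑-allFin (cutEdge C x)))

  cutEdge≢0 : ∀ C x y → cutEdge C x y ≢ 0 → fwd x y ≡ 1 × C y ≡ not (C x)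
  cutEdge≢0 C x y ≢0 with isEdgeᵇ x y in edge | C x | C y
  ... | true | true | false = ≡ᵇ⇒≡ (fwd x y) 1 (subst T (sym edge) _) , refl
  ... | true | false | true = ≡ᵇ⇒≡ (fwd x y) 1 (subst T (sym edge) _) , refl
  ... | true | true | true = ⊥-elim (≢0 refl)
  ... | true | false | false = ⊥-elim (≢0 refl)
  ... | false | _ | _ = ⊥-elim (≢0 refl)

  cutEdge≡1 : ∀ C {x y} → fwd x y ≡ 1 → C y ≡ not (C x) → cutEdge C x y ≡ 1
  cutEdge≡1 C {x} {y} edge flip with isEdgeᵇ x y in e
  ... | false = ⊥-elim (subst T e (≡⇒≡ᵇ (fwd x y) 1 edge))
  ... | true with C x | C y
  ...   | true | false = refl
  ...   | false | true = refl
  ...   | true | true = ⊥-elim (not-¬ refl flip)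
  ...   | false | false = ⊥-elim (not-¬ refl flip)

  cutEdge≡0 : ∀ C x y → (cutEdge C x y ≢ 0 → ⊥) → cutEdge C x y ≡ 0
  cutEdge≡0 C x y = decidable-stable (cutEdge C x y ≟ 0)

  module _ {C : VSet n} (Cr : C r ≡ false) (C-convex : Convex C) {m M : Fin n} (Cm : C m ≡ true) (CM : C M ≡ true)
           (m-min : ∀ y → C y ≡ true → pos m ≤ pos y) (M-max : ∀ y → C y ≡ true → pos y ≤ pos M) where

    private
      inside : ∀ y → pos m ≤ pos y → pos y ≤ pos M → C y ≡ true
      inside y m≤y y≤M = C-convex m y M Cm CM (inj₁ (m≤y , y≤M))

      -- an interval containing both ends of the path would contain r
      not-both-ends : ∀ {x z} → C x ≡ true → C z ≡ true → pos x ≡ 0 → suc (pos z) ≡ n → ⊥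
      not-both-ends {x} {z} Cx Cz x≡0 1+z≡n = not-¬ (C-convex x r z Cx Cz
        (inj₁ (subst (_≤ pos r) (sym x≡0) z≤n , ≤-pred (subst (pos r <_) (sym 1+z≡n) (pos<n r))))) Cr

      exit : ∀ x y → fwd x y ≡ 1 → C x ≡ true → C y ≡ false → x ≡ M
      exit x y edge Cx Cy with edge⇒pos-suc x y edge
      ... | inj₁ y≡1+x = pos-injective (≤-antisym (M-max x Cx) (≮⇒≥ λ x<M →
              not-¬ (inside y (≤-trans (m-min x Cx) (subst (pos x ≤_) (sym y≡1+x) (n≤1+n _)))
                              (subst (_≤ pos M) (sym y≡1+x) x<M)) Cy))
      ... | inj₂ (1+x≡n , _) = pos-injective (≤-antisym (M-max x Cx) (≤-pred (subst (pos M <_) (sym 1+x≡n) (pos<n M))))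

      entry : ∀ x y → fwd x y ≡ 1 → C x ≡ false → C y ≡ true → y ≡ m
      entry x y edge Cx Cy with edge⇒pos-suc x y edge
      ... | inj₁ y≡1+x = pos-injective (≤-antisym (≮⇒≥ λ y<m →
              not-¬ (inside x (≤-pred (subst (pos m <_) y≡1+x y<m))
                              (≤-trans (subst (pos x ≤_) (sym y≡1+x) (n≤1+n _)) (M-max y Cy))) Cx) (m-min y Cy))
      ... | inj₂ (_ , y≡0) = pos-injective (trans y≡0 (sym (n≤0⇒n≡0 (subst (pos m ≤_) y≡0 (m-min y Cy)))))

      after : Fin n
      after = proj₁ (successor 2≤n M)

      M→after : fwd M after ≡ 1
      M→after = proj₂ (successor 2≤n M)

      before : Fin n
      before = proj₁ (predecessor 2≤n m)

      before→m : fwd before m ≡ 1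
      before→m = proj₂ (predecessor 2≤n m)

      C-after : C after ≡ false
      C-after = ¬-not λ C-after → case (edge⇒pos-suc M after M→after) C-after
        where
        case : (pos after ≡ suc (pos M)) ⊎ (suc (pos M) ≡ n × pos after ≡ 0) → C after ≡ true → ⊥
        case (inj₁ after≡1+M) C-after = <-irrefl refl (subst (_≤ pos M) after≡1+M (M-max after C-after))
        case (inj₂ (1+M≡n , after≡0)) C-after = not-both-ends C-after CM after≡0 1+M≡n

      C-before : C before ≡ false
      C-before = ¬-not λ C-before → case (edge⇒pos-suc before m before→m) C-before
        where
        case : (pos m ≡ suc (pos before)) ⊎ (suc (pos before) ≡ n × pos m ≡ 0) → C before ≡ true → ⊥
        case (inj₁ m≡1+before) C-before = <-irrefl refl (subst (_≤ pos before) m≡1+before (m-min before C-before))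
        case (inj₂ (1+before≡n , m≡0)) C-before = not-both-ends Cm C-before m≡0 1+before≡n

      M≢before : M ≢ before
      M≢before M≡before = not-¬ CM (subst (λ z → C z ≡ false) (sym M≡before) C-before)

      only : ∀ x y → cutEdge C x y ≢ 0 → (x ≡ M × y ≡ after) ⊎ (x ≡ before × y ≡ m)
      only x y ≢0 with cutEdge≢0 C x y ≢0
      ... | edge , flip with C x in Cx
      ...   | true = inj₁ (x≡M , successor-unique x edge (subst (λ z → fwd z after ≡ 1) (sym x≡M) M→after))
        where
        x≡M : x ≡ M
        x≡M = exit x y edge Cx flip
      ...   | false = inj₂ (predecessor-unique y edge (subst (λ z → fwd before z ≡ 1) (sym y≡m) before→m) , y≡m)
        where
        y≡m : y ≡ m
        y≡m = entry x y edge Cx flip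

      other-row : ∀ x → x ≢ M → x ≢ before → ∑ (cutEdge C x) ≡ 0
      other-row x x≢M x≢before = ∑-zero _ λ y → cutEdge≡0 C x y λ ≢0 →
        [ x≢M ∘ proj₁ , x≢before ∘ proj₁ ]′ (only x y ≢0)

      row-M : ∀ y → y ≢ after → cutEdge C M y ≡ 0
      row-M y y≢after = cutEdge≡0 C M y λ ≢0 → [ y≢after ∘ proj₂ , M≢before ∘ proj₁ ]′ (only M y ≢0)

      row-before : ∀ y → y ≢ m → cutEdge C before y ≡ 0
      row-before y y≢m = cutEdge≡0 C before y λ ≢0 → [ M≢before ∘ sym ∘ proj₁ , y≢m ∘ proj₂ ]′ (only before y ≢0)

    cutEdges-of-interval : ∑ (λ x → ∑ (cutEdge C x)) ≡ 2
    cutEdges-of-interval = begin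
      ∑ (λ x → ∑ (cutEdge C x))                 ≡⟨ ∑-pair _ M≢before other-row ⟩
      ∑ (cutEdge C M) + ∑ (cutEdge C before)    ≡⟨ cong₂ _+_ (∑-single _ after row-M) (∑-single _ m row-before) ⟩
      cutEdge C M after + cutEdge C before m    ≡⟨ cong₂ _+_ (cutEdge≡1 C M→after (trans C-after (cong not (sym CM))))
                                                             (cutEdge≡1 C before→m (trans Cm (cong not (sym C-before)))) ⟩
      2                                         ∎
      where open ≡-Reasoning

  interval⇒cut : ∀ C → Interval C → InCG r C
  interval⇒cut C (Cr , (x , Cx) , convex) = Cr , decidable-stable (cutSize C ≟ 2) λ ≢2 →
    ¬¬-least Occupied (pos x) (x , Cx , refl) λ { (_ , (m , Cm , refl) , least) →
    ¬¬-greatest Occupied n (λ { _ (y , _ , refl) → <⇒≤ (pos<n y) }) (pos x) (x , Cx , refl) λ { (_ , (M , CM , refl) , greatest) →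
    ≢2 (trans (cutSize≡∑ C) (cutEdges-of-interval Cr convex Cm CM
      (λ y Cy → least (pos y) (y , Cy , refl)) (λ y Cy → greatest (pos y) (y , Cy , refl)))) } }
    where
    Occupied : ℕ → Set
    Occupied k = Σ (Fin n) λ y → C y ≡ true × pos y ≡ k

  convex-crossing : ∀ {C} → Convex C → ∀ {a b c d} → C a ≡ true → C b ≡ true → Cross a b c d → C c ≡ true ⊎ C d ≡ true
  convex-crossing {C} convex {a} {b} {c} {d} Ca Cb (_ , _ , _ , _ , arc-ab , arc-ba) with ≤-total (pos a) (pos b)
  ... | inj₁ a≤b = [ (λ ac≤ab → inj₁ (convex a c b Ca Cb (inj₁ (arc-pos a≤b ac≤ab))))
                   , (λ ad≤ab → inj₂ (convex a d b Ca Cb (inj₁ (arc-pos a≤b ad≤ab)))) ]′ arc-ab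
  ... | inj₂ b≤a = [ (λ bc≤ba → inj₁ (convex b c a Cb Ca (inj₁ (arc-pos b≤a bc≤ba))))
                   , (λ bd≤ba → inj₂ (convex b d a Cb Ca (inj₁ (arc-pos b≤a bd≤ba)))) ]′ arc-ba

  singleton : Fin n → VSet n
  singleton v x = isYes (x ≟ᶠ v)

  singleton-self : ∀ v → singleton v v ≡ true
  singleton-self v with v ≟ᶠ v
  ... | yes _ = refl
  ... | no v≢v = ⊥-elim (v≢v refl)

  singleton-other : ∀ {v x} → x ≢ v → singleton v x ≡ false
  singleton-other {v} {x} x≢v with x ≟ᶠ v
  ... | yes x≡v = ⊥-elim (x≢v x≡v)
  ... | no _ = refl

  singleton⇒≡ : ∀ {v x} → singleton v x ≡ true → x ≡ v
  singleton⇒≡ {v} {x} _ with x ≟ᶠ v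
  ... | yes x≡v = x≡v

  singleton-interval : ∀ {v} → v ≢ r → Interval (singleton v)
  singleton-interval {v} v≢r = singleton-other (v≢r ∘ sym) , (v , singleton-self v) , λ x y z Cx Cz y∈xz →
    subst (λ t → singleton v t ≡ true)
      (pos-injective (sym (between-same (subst₂ (λ p q → Between (pos p) (pos y) (pos q)) (singleton⇒≡ Cx) (singleton⇒≡ Cz) y∈xz))))
      (singleton-self v)

  ∪-interval : ∀ {C₁ C₂ z} → Interval C₁ → Interval C₂ → C₁ z ≡ true → C₂ z ≡ true →
               Interval (λ x → C₁ x ∨ C₂ x)
  ∪-interval {C₁} {C₂} {z} (C₁r , _ , convex₁) (C₂r , _ , convex₂) C₁z C₂z =
    cong₂ _∨_ C₁r C₂r , (z , cong (_∨ C₂ z) C₁z) , convex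
    where
    inj₁ᶜ : ∀ {y} → C₁ y ≡ true → C₁ y ∨ C₂ y ≡ true
    inj₁ᶜ {y} C₁y = cong (_∨ C₂ y) C₁y
    inj₂ᶜ : ∀ {y} → C₂ y ≡ true → C₁ y ∨ C₂ y ≡ true
    inj₂ᶜ {y} C₂y = trans (cong (C₁ y ∨_) C₂y) (∨-zeroʳ (C₁ y))
    convex : Convex (λ x → C₁ x ∨ C₂ x)
    convex x y w Cx Cw xyw with ∨≡true (C₁ x) Cx | ∨≡true (C₁ w) Cw
    ... | inj₁ C₁x | inj₁ C₁w = inj₁ᶜ (convex₁ x y w C₁x C₁w xyw)
    ... | inj₂ C₂x | inj₂ C₂w = inj₂ᶜ (convex₂ x y w C₂x C₂w xyw)
    ... | inj₁ C₁x | inj₂ C₂w =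
      [ inj₁ᶜ ∘ convex₁ x y z C₁x C₁z , inj₂ᶜ ∘ convex₂ z y w C₂z C₂w ]′ (between-split (pos z) xyw)
    ... | inj₂ C₂x | inj₁ C₁w =
      [ inj₂ᶜ ∘ convex₂ x y z C₂x C₂z , inj₁ᶜ ∘ convex₁ z y w C₁z C₁w ]′ (between-split (pos z) xyw)

  module _ (r-end : IsEnd r) {C : VSet n} (Cr : C r ≡ false) (two : ∑ (λ x → ∑ (cutEdge C x)) ≡ 2) where

    private
      colour : ℕ → Bool
      colour k = C (vertexAt k)

      colour-pos : ∀ x → colour (pos x) ≡ C x
      colour-pos x = cong C (vertexAt-pos x)

      Change : ℕ → Set
      Change k = suc k < n × colour (suc k) ≡ not (colour k)

      change-between : ∀ {i j} β → i ≤ j → j < n → colour i ≡ β → colour j ≡ not β →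
                       Σ ℕ λ k → i ≤ k × k < j × Change k
      change-between β i≤j j<n ci cj with colour-change colour β i≤j ci cj
      ... | k , i≤k , k<j , ck , ck+1 = k , i≤k , k<j , ≤-<-trans k<j j<n , trans ck+1 (cong not (sym ck))

      row-of-change : ∀ {k} → Change k → 1 ≤ ∑ (cutEdge C (vertexAt k))
      row-of-change {k} (1+k<n , flip) = subst (_≤ ∑ (cutEdge C (vertexAt k))) edge≡1 (∑-point-≤ _ (vertexAt (suc k)))
        where
        edge≡1 : cutEdge C (vertexAt k) (vertexAt (suc k)) ≡ 1
        edge≡1 = cutEdge≡1 C (pos-suc⇒edge (trans (pos-vertexAt 1+k<n) (cong suc (sym (pos-vertexAt (<⇒≤ 1+k<n)))))) flip

      -- three colour changes would give three cut edges
      at-most-two-changes : ∀ {k₁ k₂ k₃} → Change k₁ → Change k₂ → Change k₃ → k₁ < k₂ → k₂ < k₃ → ⊥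
      at-most-two-changes {k₁} {k₂} {k₃} c₁ c₂ c₃ k₁<k₂ k₂<k₃ =
        <⇒≱ (s≤s (s≤s (s≤s z≤n))) (subst (3 ≤_) two (≤-trans
          (+-mono-≤ (row-of-change c₁) (+-mono-≤ (row-of-change c₂) (row-of-change c₃)))
          (∑-triple-≤ (λ x → ∑ (cutEdge C x)) (distinct c₁ c₂ (<⇒≢ k₁<k₂))
                      (distinct c₁ c₃ (<⇒≢ (<-trans k₁<k₂ k₂<k₃))) (distinct c₂ c₃ (<⇒≢ k₂<k₃)))))
        where
        distinct : ∀ {i j} → Change i → Change j → i ≢ j → vertexAt i ≢ vertexAt j
        distinct (i<n , _) (j<n , _) i≢j e = i≢j (trans (sym (pos-vertexAt (<⇒≤ i<n))) (trans (cong pos e) (pos-vertexAt (<⇒≤ j<n))))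

      no-gap : ∀ {x y z} → C x ≡ true → C y ≡ false → C z ≡ true → pos x < pos y → pos y < pos z → ⊥
      no-gap {x} {y} {z} Cx Cy Cz x<y y<z
        with change-between true (<⇒≤ x<y) (pos<n y) (trans (colour-pos x) Cx) (trans (colour-pos y) Cy)
           | change-between false (<⇒≤ y<z) (pos<n z) (trans (colour-pos y) Cy) (trans (colour-pos z) Cz)
      ... | k₁ , x≤k₁ , k₁<y , c₁ | k₂ , y≤k₂ , k₂<z , c₂ = third r-end
        where
        k₁<k₂ : k₁ < k₂
        k₁<k₂ = <-≤-trans k₁<y y≤k₂
        third : IsEnd r → ⊥
        third (inj₁ r≡0) with change-between false z≤n (pos<n x)
                                (trans (cong colour (sym r≡0)) (trans (colour-pos r) Cr)) (trans (colour-pos x) Cx)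
        ... | k₃ , _ , k₃<x , c₃ = at-most-two-changes c₃ c₁ c₂ (<-≤-trans k₃<x x≤k₁) k₁<k₂
        third (inj₂ 1+r≡n) with change-between true (≤-pred (subst (pos z <_) (sym 1+r≡n) (pos<n z))) (pos<n r)
                                  (trans (colour-pos z) Cz) (trans (colour-pos r) Cr)
        ... | k₃ , z≤k₃ , _ , c₃ = at-most-two-changes c₁ c₂ c₃ k₁<k₂ (<-≤-trans k₂<z z≤k₃)

    cut-convex : Convex C
    cut-convex x y z Cx Cz xyz = ¬¬-true λ ¬Cy → gap (¬-not ¬Cy) xyz
      where
      pos≢ : ∀ {a c} → C a ≡ true → C c ≡ false → pos a ≢ pos c
      pos≢ Ca Cc e = not-¬ Ca (subst (λ w → C w ≡ false) (sym (pos-injective e)) Cc)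
      gap : C y ≡ false → Between (pos x) (pos y) (pos z) → ⊥
      gap Cy (inj₁ (x≤y , y≤z)) = no-gap Cx Cy Cz (≤∧≢⇒< x≤y (pos≢ Cx Cy)) (≤∧≢⇒< y≤z (pos≢ Cz Cy ∘ sym))
      gap Cy (inj₂ (z≤y , y≤x)) = no-gap Cz Cy Cx (≤∧≢⇒< z≤y (pos≢ Cz Cy)) (≤∧≢⇒< y≤x (pos≢ Cx Cy ∘ sym))

    cut-nonempty : ∃[ x ] C x ≡ true
    cut-nonempty = decidable-stable (any? (λ x → C x ≟ᵇ true)) λ empty →
      0≢1+n (trans (sym (∑-zero _ λ x → ∑-zero _ λ y → no-edge x y empty)) two)
      where
      no-edge : ∀ x y → ¬ (∃[ x ] C x ≡ true) → cutEdge C x y ≡ 0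
      no-edge x y empty = cutEdge≡0 C x y λ ≢0 → empty (endpoint-in-C (C x) refl (proj₂ (cutEdge≢0 C x y ≢0)))
        where
        endpoint-in-C : ∀ c → C x ≡ c → C y ≡ not c → ∃[ x ] C x ≡ true
        endpoint-in-C true Cx _ = x , Cx
        endpoint-in-C false _ Cy = y , Cy

  cut⇒interval : IsEnd r → ∀ C → InCG r C → Interval C
  cut⇒interval r-end C (Cr , two) = Cr , cut-nonempty r-end Cr two′ , cut-convex r-end Cr two′
    where
    two′ : ∑ (λ x → ∑ (cutEdge C x)) ≡ 2
    two′ = trans (sym (cutSize≡∑ C)) two

-- Connected link sets

module ConnectedLinks {n : ℕ} (2≤n : 2 ≤ n) (base r : Fin n) {S : ULinks n} (S-sym : ∀ x y → S x y ≡ S y x)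
                      {C : VSet n} (convex : Cuts.Convex 2≤n base r C) (uncut : ¬ CutNonEmpty S C) where

  both-ends-inside : ∀ {c d} → S c d ≡ true → C c ≡ true ⊎ C d ≡ true → C c ≡ true × C d ≡ true
  both-ends-inside {c} {d} Scd (inj₁ Cc) = Cc , ¬¬-true λ ¬Cd → uncut (c , d , Scd , Cc , ¬-not ¬Cd)
  both-ends-inside {c} {d} Scd (inj₂ Cd) = ¬¬-true (λ ¬Cc → uncut (d , c , trans (S-sym d c) Scd , Cd , ¬-not ¬Cc)) , Cd

  intersecting-inside : ∀ {a b c d} → Intersect a b c d → C a ≡ true → C b ≡ true → C c ≡ true ⊎ C d ≡ true
  intersecting-inside (inj₁ (inj₁ refl)) Ca Cb = inj₁ Ca
  intersecting-inside (inj₁ (inj₂ (inj₁ refl))) Ca Cb = inj₂ Ca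
  intersecting-inside (inj₁ (inj₂ (inj₂ (inj₁ refl)))) Ca Cb = inj₁ Cb
  intersecting-inside (inj₁ (inj₂ (inj₂ (inj₂ refl)))) Ca Cb = inj₂ Cb
  intersecting-inside (inj₂ cross) Ca Cb = Cuts.convex-crossing 2≤n base r convex Ca Cb cross

  walk-inside : ∀ {a b c d} → HWalk S a b c d → C a ≡ true → C b ≡ true → C c ≡ true × C d ≡ true
  walk-inside hhere Ca Cb = Ca , Cb
  walk-inside (hstep Scd meets rest) Ca Cb =
    let (Cc , Cd) = both-ends-inside Scd (intersecting-inside meets Ca Cb) in walk-inside rest Cc Cd

  VS-inside : HConnected S → ∀ {v} → InVS S v → C v ≡ true → ∀ x → InVS S x → C x ≡ true
  VS-inside (_ , walks) {v} v∈VS Cv x x∈VS with link-at v∈VS | link-at x∈VS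
    where
    link-at : ∀ {y} → InVS S y → Σ (Fin n) λ y′ → S y y′ ≡ true
    link-at (y′ , inj₁ Syy′) = y′ , Syy′
    link-at {y} (y′ , inj₂ Sy′y) = y′ , trans (S-sym y y′) Sy′y
  ... | v′ , Svv′ | x′ , Sxx′ = proj₁ (walk-inside (walks v v′ x x′ Svv′ Sxx′) Cv (proj₂ (both-ends-inside Svv′ (inj₁ Cv))))

module _ {n : ℕ} {F : DLinks n} where

  walk-++ : ∀ {s t u k m} → Walk F s t k → Walk F t u m → Walk F s u (k + m)
  walk-++ here w = w
  walk-++ (step e w₁) w = step e (walk-++ w₁ w)

  walk-zero : ∀ {s t} → Walk F s t 0 → s ≡ t
  walk-zero here = refl

  walk-last : ∀ {s t k} → Walk F s t (suc k) → Σ (Fin n) λ t′ → Walk F s t′ k × F t′ t ≡ true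
  walk-last (step e here) = _ , here , e
  walk-last (step e (step e′ w)) with walk-last (step e′ w)
  ... | t′ , w′ , e″ = t′ , step e w′ , e″

  ancestor-refl : ∀ {s} → Ancestor F s s
  ancestor-refl = 0 , here

  ancestor-trans : ∀ {s t u} → Ancestor F s t → Ancestor F t u → Ancestor F s u
  ancestor-trans (k , w) (m , w′) = k + m , walk-++ w w′

  ancestor-link : ∀ {s t} → F s t ≡ true → Ancestor F s t
  ancestor-link e = 1 , step e here

  ancestor-step : ∀ {s t u} → F s t ≡ true → Ancestor F t u → Ancestor F s u
  ancestor-step e (k , w) = suc k , step e w

delete-other : ∀ {n} (F : DLinks n) u v a c → ¬ (a ≡ u × c ≡ v) → delete F u v a c ≡ F a c
delete-other F u v a c ≢uv with a ≟ᶠ u | c ≟ᶠ v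
... | yes a≡u | yes c≡v = ⊥-elim (≢uv (a≡u , c≡v))
... | yes _ | no _ = refl
... | no _ | yes _ = refl
... | no _ | no _ = refl

replace-new : ∀ {n} (F : DLinks n) u v s → replace F u v s s v ≡ true
replace-new F u v s with s ≟ᶠ s | v ≟ᶠ v
... | yes _ | yes _ = refl
... | no s≢s | _ = ⊥-elim (s≢s refl)
... | yes _ | no v≢v = ⊥-elim (v≢v refl)

replace-other : ∀ {n} (F : DLinks n) u v s a c → ¬ (a ≡ s × c ≡ v) → ¬ (a ≡ u × c ≡ v) →
                replace F u v s a c ≡ F a c
replace-other F u v s a c ≢sv ≢uv with a ≟ᶠ s | c ≟ᶠ v
... | yes a≡s | yes c≡v = ⊥-elim (≢sv (a≡s , c≡v))
... | yes _ | no _ = delete-other F u v a c ≢uv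
... | no _ | yes _ = delete-other F u v a c ≢uv
... | no _ | no _ = delete-other F u v a c ≢uv

covered? : ∀ {n} (D : DLinks n) (C : VSet n) → Dec (∃[ u ] ∃[ v ] (D u v ≡ true × Covers u v C))
covered? D C = any? λ u → any? λ v → (D u v ≟ᵇ true) ×-dec ((C v ≟ᵇ true) ×-dec (C u ≟ᵇ false))

¬feasible⇒uncovered-cut : ∀ {n} (r : Fin n) (D : DLinks n) → ¬ Feasible r D →
  ¬ ¬ (Σ (VSet n) λ C → InCG r C × ¬ (∃[ u ] ∃[ v ] (D u v ≡ true × Covers u v C)))
¬feasible⇒uncovered-cut r D infeasible k = infeasible λ C C∈𝒞 →
  decidable-stable (covered? D C) λ uncovered → k (C , C∈𝒞 , uncovered)

-- Structure of a non-shortenable solution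

module NonShortenableSolution {n : ℕ} (2≤n : 2 ≤ n) (ea eb r : Fin n) (r-end : Position.IsEnd eb r)
                              (F : DLinks n) (non-shortenable : NonShortenable r ea eb F) where
  open Position eb
  open Cuts 2≤n eb r

  private
    feasible : Feasible r F
    feasible = proj₁ non-shortenable

    undeletable : ∀ u v → F u v ≡ true → ¬ Feasible r (delete F u v)
    undeletable = proj₁ (proj₂ non-shortenable)

    unshortenable : ∀ u v s → F u v ≡ true → IsShortening ea eb u v s v → s ≢ u → ¬ Feasible r (replace F u v s)
    unshortenable = proj₂ (proj₂ non-shortenable)

  OnlyCoveredBy : VSet n → Fin n → Fin n → Set
  OnlyCoveredBy C u v = ∀ a c → F a c ≡ true → Covers a c C → a ≡ u × c ≡ v

  -- a cut showing that the link (u , v) is needed, and that it is needed in full length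
  WitnessCut : Fin n → Fin n → Set
  WitnessCut u v = Σ (VSet n) λ C → Interval C × Covers u v C × OnlyCoveredBy C u v ×
                     (∀ s → StrictlyBetween (pos u) (pos s) (pos v) → C s ≡ true)

  private
    module Uncovered {u v} {D : DLinks n} (D⊇F : ∀ a c → F a c ≡ true → ¬ (a ≡ u × c ≡ v) → D a c ≡ true)
                     {C} (C∈𝒞 : InCG r C) (uncovered : ¬ (∃[ a ] ∃[ c ] (D a c ≡ true × Covers a c C))) where

      only : OnlyCoveredBy C u v
      only a c Fac covers with (a ≟ᶠ u) ×-dec (c ≟ᶠ v)
      ... | yes uv = uv
      ... | no ≢uv = ⊥-elim (uncovered (a , c , D⊇F a c Fac ≢uv , covers))

      covering : Covers u v C
      covering with feasible C C∈𝒞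
      ... | a , c , Fac , covers with only a c Fac covers
      ...   | refl , refl = covers

  witness-by-deletion : ∀ {u v} → F u v ≡ true → (∀ t → ¬ StrictlyBetween (pos u) (pos t) (pos v)) →
                        ¬ ¬ WitnessCut u v
  witness-by-deletion {u} {v} Fuv empty k =
    ¬feasible⇒uncovered-cut r (delete F u v) (undeletable u v Fuv) λ { (C , C∈𝒞 , uncovered) →
      k (C , cut⇒interval r-end C C∈𝒞 , Uncovered.covering D⊇F C∈𝒞 uncovered ,
         Uncovered.only D⊇F C∈𝒞 uncovered , λ t t∈uv → ⊥-elim (empty t t∈uv)) }
    where
    D⊇F : ∀ a c → F a c ≡ true → ¬ (a ≡ u × c ≡ v) → delete F u v a c ≡ true
    D⊇F a c Fac ≢uv = trans (delete-other F u v a c ≢uv) Fac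

  -- the cut left uncovered by shortening (u , v) to (s , v) contains s, hence everything from s to v
  witness-by-shortening : ∀ {u v s} → F u v ≡ true → StrictlyBetween (pos u) (pos s) (pos v) →
                          (∀ t → StrictlyBetween (pos u) (pos t) (pos v) → Between (pos s) (pos t) (pos v)) →
                          ¬ ¬ WitnessCut u v
  witness-by-shortening {u} {v} {s} Fuv s∈uv beyond k =
    ¬feasible⇒uncovered-cut r (replace F u v s)
      (unshortenable u v s Fuv (refl , strictlyBetween-≢ʳ s∈uv ∘ cong pos , strictly⇒between s∈uv) (strictlyBetween-≢ˡ s∈uv ∘ cong pos))
      λ { (C , C∈𝒞 , uncovered) →
        let interval : Interval C
            interval = cut⇒interval r-end C C∈𝒞
            covering : Covers u v C
            covering = Uncovered.covering D⊇F C∈𝒞 uncovered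
            Cs : C s ≡ true
            Cs = ¬¬-true λ ¬Cs → uncovered (s , v , replace-new F u v s , proj₁ covering , ¬-not ¬Cs)
        in k (C , interval , covering , Uncovered.only D⊇F C∈𝒞 uncovered ,
              λ t t∈uv → proj₂ (proj₂ interval) s t v Cs (proj₁ covering) (beyond t t∈uv)) }
    where
    D⊇F : ∀ a c → F a c ≡ true → ¬ (a ≡ u × c ≡ v) → replace F u v s a c ≡ true
    D⊇F a c Fac ≢uv with (a ≟ᶠ s) ×-dec (c ≟ᶠ v)
    ... | yes (refl , refl) = replace-new F u v s
    ... | no ≢sv = trans (replace-other F u v s a c ≢sv ≢uv) Fac

  witness : ∀ {u v} → F u v ≡ true → ¬ ¬ WitnessCut u v
  witness {u} {v} Fuv with any? (λ t → strictlyBetween? (pos u) (pos t) (pos v))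
  ... | yes (t , t∈uv) = let (s , s∈uv , beyond) = step-toward t∈uv in witness-by-shortening Fuv s∈uv beyond
  ... | no empty = witness-by-deletion Fuv λ t t∈uv → empty (t , t∈uv)

  -- The union of the two cuts is a cut, and the link covering it covers one of them with its tail in the other.
  overlapping-witnesses : ∀ {C₁ C₂ u₁ v₁ u₂ v₂ z} → Interval C₁ → Interval C₂ →
    OnlyCoveredBy C₁ u₁ v₁ → OnlyCoveredBy C₂ u₂ v₂ → C₁ u₁ ≡ false → C₂ u₂ ≡ false →
    C₂ u₁ ≡ true → C₁ u₂ ≡ true → C₁ z ≡ true → C₂ z ≡ true → ⊥
  overlapping-witnesses {C₁} {C₂} I₁ I₂ only₁ only₂ C₁u₁ C₂u₂ C₂u₁ C₁u₂ C₁z C₂z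
    with feasible _ (interval⇒cut _ (∪-interval I₁ I₂ C₁z C₂z))
  ... | a , c , Fac , C∪c , C∪a with ∨≡true (C₁ c) C∪c
  ...   | inj₁ C₁c with only₁ a c Fac (C₁c , ∨-conicalˡ _ _ C∪a)
  ...     | refl , _ = not-¬ C₂u₁ (∨-conicalʳ _ _ C∪a)
  overlapping-witnesses {C₁} {C₂} I₁ I₂ only₁ only₂ C₁u₁ C₂u₂ C₂u₁ C₁u₂ C₁z C₂z
    | a , c , Fac , C∪c , C∪a | inj₂ C₂c with only₂ a c Fac (C₂c , ∨-conicalʳ _ _ C∪a)
  ...     | refl , _ = not-¬ C₁u₂ (∨-conicalˡ _ _ C∪a)

  no-link-into-root : ∀ {u} → F u r ≡ true → ⊥
  no-link-into-root Fur = witness Fur λ { (C , (Cr , _) , (Cr′ , _) , _) → not-¬ Cr′ Cr }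

  no-loop : ∀ {u} → F u u ≡ true → ⊥
  no-loop Fuu = witness Fuu λ { (C , _ , (Cu , Cu′) , _) → not-¬ Cu Cu′ }

  parent-unique : ∀ {a c v} → F a v ≡ true → F c v ≡ true → a ≡ c
  parent-unique {a} {c} {v} Fav Fcv = decidable-stable (a ≟ᶠ c) λ a≢c →
    witness Fav λ { (C₁ , I₁ , (C₁v , C₁a) , only₁ , _) →
    witness Fcv λ { (C₂ , I₂ , (C₂v , C₂c) , only₂ , _) →
      overlapping-witnesses I₁ I₂ only₁ only₂ C₁a C₂c
        (¬¬-true λ ¬C₂a → a≢c (proj₁ (only₂ a v Fav (C₂v , ¬-not ¬C₂a))))
        (¬¬-true λ ¬C₁c → a≢c (sym (proj₁ (only₁ c v Fcv (C₁v , ¬-not ¬C₁c)))))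
        C₁v C₂v } }

  -- If p were outside the span, p would lie in the witness cut of (a , c) and a in that of (p , z),
  -- and these two cuts overlap at z.
  link-into-span : ∀ {a c p z} → F a c ≡ true → StrictlyBetween (pos a) (pos z) (pos c) →
                   F p z ≡ true → p ≢ c → StrictlyBetween (pos a) (pos p) (pos c)
  link-into-span {a} {c} {p} {z} Fac z∈ac Fpz p≢c = decidable-stable (strictlyBetween? _ _ _) λ p∉ac →
    witness Fac λ { (C₁ , I₁ , (C₁c , C₁a) , only₁ , span₁) →
    witness Fpz λ { (C₂ , I₂ , (C₂z , C₂p) , only₂ , span₂) →
      let C₁z : C₁ z ≡ true
          C₁z = span₁ z z∈ac
          C₁p : C₁ p ≡ true
          C₁p = ¬¬-true λ ¬C₁p → strictlyBetween-≢ʳ z∈ac (cong pos (proj₂ (only₁ p z Fpz (C₁z , ¬-not ¬C₁p))))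
          p≢a : p ≢ a
          p≢a p≡a = not-¬ C₁p (subst (λ t → C₁ t ≡ false) (sym p≡a) C₁a)
          C₂a : C₂ a ≡ true
          C₂a = [ span₂ a , (λ c∈zp → ¬¬-true λ ¬C₂a → strictlyBetween-≢ʳ z∈ac
                    (cong pos (sym (proj₂ (only₂ a c Fac (span₂ c (strictlyBetween-sym c∈zp) , ¬-not ¬C₂a)))))) ]′
                  (¬strictlyBetween p∉ac (p≢a ∘ pos-injective) (p≢c ∘ pos-injective) z∈ac)
      in overlapping-witnesses I₁ I₂ only₁ only₂ C₁a C₂p C₂a C₁p C₁z C₂z } }

  acyclic : ∀ {x j} → Ancestor F r x → Walk F x x (suc j) → ⊥
  acyclic (k , w) = go k w
    where
    go : ∀ k {x j} → Walk F r x k → Walk F x x (suc j) → ⊥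
    go zero w cycle with walk-zero w
    ... | refl = no-link-into-root (proj₂ (proj₂ (walk-last cycle)))
    go (suc k) w cycle with walk-last w | walk-last cycle
    ... | y , w′ , Fyx | z , cycle′ , Fzx with parent-unique Fyx Fzx
    ...   | refl = go k w′ (step Fyx cycle′)

  no-back-link : ∀ {x y} → Ancestor F r x → Ancestor F x y → F y x ≡ true → ⊥
  no-back-link rx (k , w) Fyx = acyclic rx (subst (Walk F _ _) (+-comm k 1) (walk-++ w (step Fyx here)))

  comparable-walks : ∀ k m {a c y} → Walk F a y k → Walk F c y m →
    (Σ ℕ λ j → Walk F a c j × j + m ≡ k) ⊎ (Σ ℕ λ j → Walk F c a j × j + k ≡ m)
  comparable-walks zero m wa wc with walk-zero wa
  ... | refl = inj₂ (m , wc , +-identityʳ m)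
  comparable-walks (suc k) zero wa wc with walk-zero wc
  ... | refl = inj₁ (suc k , wa , +-identityʳ (suc k))
  comparable-walks (suc k) (suc m) wa wc with walk-last wa | walk-last wc
  ... | y₁ , wa′ , e₁ | y₂ , wc′ , e₂ with parent-unique e₁ e₂
  ...   | refl with comparable-walks k m wa′ wc′
  ...     | inj₁ (j , w , j+m≡k) = inj₁ (j , w , trans (+-suc j m) (cong suc j+m≡k))
  ...     | inj₂ (j , w , j+k≡m) = inj₂ (j , w , trans (+-suc j k) (cong suc j+k≡m))

  comparable : ∀ {a c y} → Ancestor F a y → Ancestor F c y → Ancestor F a c ⊎ Ancestor F c a
  comparable (k , wa) (m , wc) with comparable-walks k m wa wc
  ... | inj₁ (j , w , _) = inj₁ (j , w)
  ... | inj₂ (j , w , _) = inj₂ (j , w)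

  stays-outside : ∀ (C : VSet n) u {s t k} → Walk F s t k → Ancestor F r s → Ancestor F t u → C s ≡ false →
                  (∀ a c → OnRootPath r F u a c → ¬ Covers a c C) → C t ≡ false
  stays-outside C u here rs tu Cs uncovered = Cs
  stays-outside C u {s} (step {y = s′} e w) rs tu Cs uncovered =
    stays-outside C u w (ancestor-trans rs (ancestor-link e)) tu
      (¬-not λ Cs′ → uncovered s s′ (rs , e , ancestor-trans (_ , w) tu) (Cs′ , Cs)) uncovered

  walk-into-span : ∀ {a c s g k} → F a c ≡ true → Walk F s g k → StrictlyBetween (pos a) (pos g) (pos c) →
                   StrictlyBetween (pos a) (pos s) (pos c) ⊎ (Ancestor F s c × Ancestor F c g)
  walk-into-span Fac here g∈ac = inj₁ g∈ac
  walk-into-span {c = c} {s = s} Fac (step e w) g∈ac with walk-into-span Fac w g∈ac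
  ... | inj₂ (tc , cg) = inj₂ (ancestor-step e tc , cg)
  ... | inj₁ t∈ac with s ≟ᶠ c
  ...   | yes refl = inj₂ (ancestor-refl , (_ , step e w))
  ...   | no s≢c = inj₁ (link-into-span Fac t∈ac e s≢c)

  -- If x were unreachable, the vertices y with no reachable vertex between x and y would form a
  -- cut, and the link of F entering that cut would lead from a reachable vertex into it.
  reachable : ∀ x → ¬ ¬ Ancestor F r x
  reachable x unreachable = ¬¬-characteristic Shielded λ { (χ , spec) → cut-entered χ spec }
    where
    Shielded : Fin n → Set
    Shielded y = ∀ z → Between (pos x) (pos z) (pos y) → ¬ Ancestor F r z

    cut-entered : (χ : VSet n) → (∀ y → χ y ≡ true ⇔ Shielded y) → ⊥
    cut-entered χ spec with feasible χ (interval⇒cut χ χ-interval)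
      where
      open Equivalence
      χ-interval : Interval χ
      χ-interval = ¬-not (λ χr → to (spec r) χr r (between-right (pos x) (pos r)) ancestor-refl)
                 , (x , from (spec x) λ z z∈xx rz → unreachable (subst (Ancestor F r) (pos-injective (between-same z∈xx)) rz))
                 , λ y₁ y y₂ χy₁ χy₂ y∈y₁y₂ → from (spec y) λ z z∈xy →
                     [ to (spec y₁) χy₁ z , to (spec y₂) χy₂ z ]′ (between-towards y∈y₁y₂ z∈xy)
    ... | p , y , Fpy , χy , χp = exposed λ { (z , z∈xp , rz) → entered z z∈xp rz }
      where
      open Equivalence
      shielded : Shielded y
      shielded = to (spec y) χy
      exposed : ¬ ¬ (Σ (Fin n) λ z → Between (pos x) (pos z) (pos p) × Ancestor F r z)
      exposed k = not-¬ (from (spec p) λ z z∈xp rz → k (z , z∈xp , rz)) χp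
      entered : ∀ z → Between (pos x) (pos z) (pos p) → Ancestor F r z → ⊥
      entered z z∈xp rz with walk-into-span Fpy (proj₂ rz) (between-beyond z∈xp (λ z∈xy → shielded z z∈xy rz) z≢p)
        where
        z≢p : pos z ≢ pos p
        z≢p e = shielded y (between-right (pos x) (pos y))
                  (ancestor-trans (subst (Ancestor F r) (pos-injective e) rz) (ancestor-link Fpy))
      ... | inj₁ r∈py = end-not-inside r-end r∈py
      ... | inj₂ (ry , _) = shielded y (between-right (pos x) (pos y)) ry

  walk-reaches-or-jumps : ∀ {s t k} y → Walk F s t k → Between (pos s) (pos y) (pos t) →
    Ancestor F s y ⊎ (Σ (Fin n) λ c → Σ (Fin n) λ d → Ancestor F s c × F c d ≡ true × Ancestor F d t ×
                                        StrictlyBetween (pos c) (pos y) (pos d))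
  walk-reaches-or-jumps y here y∈ss = inj₁ (subst (Ancestor F _) (pos-injective (sym (between-same y∈ss))) ancestor-refl)
  walk-reaches-or-jumps {s} y (step {y = s′} e w) y∈st with between-first-step (pos s′) y∈st
  ... | inj₁ y≡s = inj₁ (subst (Ancestor F s) (pos-injective (sym y≡s)) ancestor-refl)
  ... | inj₂ (inj₁ y∈ss′) = inj₂ (s , s′ , ancestor-refl , e , (_ , w) , y∈ss′)
  ... | inj₂ (inj₂ y∈s′t) with walk-reaches-or-jumps y w y∈s′t
  ...   | inj₁ s′y = inj₁ (ancestor-step e s′y)
  ...   | inj₂ (c , d , s′c , Fcd , dt , y∈cd) = inj₂ (c , d , ancestor-step e s′c , Fcd , dt , y∈cd)

  span-below-head : ∀ {u v z} → F u v ≡ true → StrictlyBetween (pos u) (pos z) (pos v) → ¬ ¬ Ancestor F v z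
  span-below-head Fuv z∈uv ¬vz = reachable _ λ rz → [ end-not-inside r-end , ¬vz ∘ proj₂ ]′ (walk-into-span Fuv (proj₂ rz) z∈uv)

  descendants-fill-span : ∀ {v t y} → Ancestor F v t → Between (pos v) (pos y) (pos t) → ¬ ¬ Ancestor F v y
  descendants-fill-span (k , w) y∈vt ¬vy with walk-reaches-or-jumps _ w y∈vt
  ... | inj₁ vy = ¬vy vy
  ... | inj₂ (c , d , vc , Fcd , _ , y∈cd) = span-below-head Fcd y∈cd λ dy → ¬vy (ancestor-trans vc (ancestor-step Fcd dy))

  descendants-convex : ∀ {v x y z} → Ancestor F v x → Ancestor F v z → Between (pos x) (pos y) (pos z) → ¬ ¬ Ancestor F v y
  descendants-convex {v} vx vz y∈xz with between-split (pos v) y∈xz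
  ... | inj₁ y∈xv = descendants-fill-span vx (between-sym y∈xv)
  ... | inj₂ y∈vz = descendants-fill-span vz y∈vz

  below-link : ∀ {u v t z} → F u v ≡ true → Ancestor F v t → Between (pos u) (pos z) (pos t) → ¬ ¬ (z ≡ u ⊎ Ancestor F v z)
  below-link {u} {v} {t} {z} Fuv vt z∈ut k with between? (pos v) (pos z) (pos t)
  ... | yes z∈vt = descendants-fill-span vt z∈vt (k ∘ inj₂)
  ... | no z∉vt with z ≟ᶠ u | z ≟ᶠ v
  ...   | yes z≡u | _ = k (inj₁ z≡u)
  ...   | no _ | yes refl = k (inj₂ ancestor-refl)
  ...   | no z≢u | no z≢v = span-below-head Fuv
            (between∧≢⇒strictly (between-shrink (pos v) z∈ut z∉vt) (z≢u ∘ pos-injective) (z≢v ∘ pos-injective)) (k ∘ inj₂)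

  siblings-disjoint : ∀ {y c₁ c₂ x} → F y c₁ ≡ true → F y c₂ ≡ true → c₁ ≢ c₂ → Ancestor F r y →
                      Ancestor F c₁ x → Ancestor F c₂ x → ⊥
  siblings-disjoint Fyc₁ Fyc₂ c₁≢c₂ ry c₁x c₂x with comparable c₁x c₂x
  ... | inj₁ (zero , w) = c₁≢c₂ (walk-zero w)
  ... | inj₁ (suc j , w) with walk-last w
  ...   | p , wp , Fpc₂ with parent-unique Fpc₂ Fyc₂
  ...     | refl = no-back-link (ancestor-trans ry (ancestor-link Fyc₁)) (_ , wp) Fyc₁
  siblings-disjoint Fyc₁ Fyc₂ c₁≢c₂ ry c₁x c₂x | inj₂ (zero , w) = c₁≢c₂ (sym (walk-zero w))
  siblings-disjoint Fyc₁ Fyc₂ c₁≢c₂ ry c₁x c₂x | inj₂ (suc j , w) with walk-last w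
  ...   | p , wp , Fpc₁ with parent-unique Fpc₁ Fyc₁
  ...     | refl = no-back-link (ancestor-trans ry (ancestor-link Fyc₂)) (_ , wp) Fyc₂

  parent-between-subtrees : ∀ {y c₁ c₂ x₁ x₂} → F y c₁ ≡ true → F y c₂ ≡ true → c₁ ≢ c₂ → Ancestor F r y →
                            Ancestor F c₁ x₁ → Ancestor F c₂ x₂ → Between (pos x₁) (pos y) (pos x₂)
  parent-between-subtrees {y} {x₁ = x₁} {x₂} Fyc₁ Fyc₂ c₁≢c₂ ry c₁x₁ c₂x₂ =
    decidable-stable (between? _ _ _) λ y∉x₁x₂ → case y∉x₁x₂ (¬between y∉x₁x₂)
    where
    case : ¬ Between (pos x₁) (pos y) (pos x₂) → Between (pos y) (pos x₁) (pos x₂) ⊎ Between (pos y) (pos x₂) (pos x₁) → ⊥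
    case y∉x₁x₂ (inj₁ x₁∈yx₂) = below-link Fyc₂ c₂x₂ x₁∈yx₂
      [ (λ x₁≡y → y∉x₁x₂ (subst (λ t → Between (pos x₁) (pos t) (pos x₂)) x₁≡y (between-left (pos x₁) (pos x₂))))
      , siblings-disjoint Fyc₁ Fyc₂ c₁≢c₂ ry c₁x₁ ]′
    case y∉x₁x₂ (inj₂ x₂∈yx₁) = below-link Fyc₁ c₁x₁ x₂∈yx₁
      [ (λ x₂≡y → y∉x₁x₂ (subst (λ t → Between (pos x₁) (pos t) (pos x₂)) x₂≡y (between-right (pos x₁) (pos x₂))))
      , (λ c₁x₂ → siblings-disjoint Fyc₁ Fyc₂ c₁≢c₂ ry c₁x₂ c₂x₂) ]′

  module _ {C : VSet n} (C-convex : Convex C) {u v} (Fuv : F u v ≡ true) (Cv : C v ≡ true)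
           (ru : Ancestor F r u) (outside : ∀ y → Ancestor F r y → Ancestor F y u → C y ≡ false) where

    -- a vertex of C below a root-path vertex y but off the path would put y between it and v
    private
      below-path : ∀ {y k} → Walk F y u k → Ancestor F r y → ∀ x → C x ≡ true → Ancestor F y x → ¬ ¬ Ancestor F v x
      below-path here ry x Cx (_ , here) = ⊥-elim (not-¬ Cx (outside u ry ancestor-refl))
      below-path here ry x Cx (_ , step {y = c} e w) with c ≟ᶠ v
      ... | yes refl = λ ¬vx → ¬vx (_ , w)
      ... | no c≢v = ⊥-elim (not-¬ (C-convex x u v Cx Cv (parent-between-subtrees e Fuv c≢v ry (_ , w) ancestor-refl))
                                    (outside u ry ancestor-refl))
      below-path {y} (step e wu) ry x Cx (_ , here) = ⊥-elim (not-¬ Cx (outside y ry (_ , step e wu)))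
      below-path {y} (step {y = y′} e wu) ry x Cx (_ , step {y = c} e′ w) with c ≟ᶠ y′
      ... | yes refl = below-path wu (ancestor-trans ry (ancestor-link e)) x Cx (_ , w)
      ... | no c≢y′ = ⊥-elim (not-¬ (C-convex x y v Cx Cv
                        (parent-between-subtrees e′ e c≢y′ ry (_ , w) (ancestor-trans (_ , wu) (ancestor-link Fuv))))
                        (outside y ry (_ , step e wu)))

    cut-below-head : ∀ x → C x ≡ true → ¬ ¬ Ancestor F v x
    cut-below-head x Cx ¬vx = reachable x λ rx → below-path (proj₂ ru) ancestor-refl x Cx rx ¬vx

  lca-deepest : ∀ {U : Fin n → Set} {w v} → IsLCA r F U w → (∀ x → U x → Ancestor F v x) → Ancestor F w v → v ≡ w
  lca-deepest _ v-common (zero , wv) = sym (walk-zero wv)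
  lca-deepest {w = w} {v} (_ , kw , (rw , rw-min) , deepest) v-common (suc j , wv) =
    ⊥-elim (¬¬-least (Walk F r v) (kw + suc j) (walk-++ rw wv) λ { (k , rv , rv-min) →
      deeper k rv (deepest v k v-common (rv , rv-min)) })
    where
    deeper : ∀ k → Walk F r v k → k ≤ kw → ⊥
    deeper k rv k≤kw with comparable-walks k (suc j) rv wv
    ... | inj₁ (i , ri , i+1+j≡k) =
      <⇒≱ (≤-trans (s≤s (≤-trans (rw-min i ri) (m≤m+n i j))) (≤-reflexive (trans (sym (+-suc i j)) i+1+j≡k))) k≤kw
    ... | inj₂ (zero , w→r , k≡1+j) with walk-zero w→r
    ...   | refl = <⇒≱ (subst (0 <_) (sym k≡1+j) z<s) (≤-trans k≤kw (rw-min 0 here))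
    deeper k rv k≤kw | inj₂ (suc i , w→r , _) = no-link-into-root (proj₂ (proj₂ (walk-last w→r)))

  head-cut : ∀ {u v} → F u v ≡ true → InCG r (singleton v) × Responsible r F u v (singleton v)
  head-cut {u} {v} Fuv = interval⇒cut _ (singleton-interval λ { refl → no-link-into-root Fuv })
                       , Fuv , (singleton-self v , singleton-other λ { refl → no-loop Fuv })
                       , λ { a b (ra , Fab , bu) (Cb , _) → enters (singleton⇒≡ Cb) ra Fab bu }
    where
    enters : ∀ {a b} → b ≡ v → Ancestor F r a → F a b ≡ true → Ancestor F b u → ⊥
    enters refl ra Fav vu = no-back-link (ancestor-trans ra (ancestor-link Fav)) vu Fuv

  subtree-cut : ∀ {u v} → F u v ≡ true → (χ : VSet n) → (∀ y → χ y ≡ true ⇔ Ancestor F v y) →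
                ¬ ¬ (InCG r χ × Responsible r F u v χ)
  subtree-cut {u} {v} Fuv χ spec k = reachable v λ rv →
    k ( interval⇒cut χ ( ¬-not (below-root ∘ to (spec r))
                       , (v , from (spec v) ancestor-refl)
                       , λ x y z χx χz y∈xz → ¬¬-true (¬¬-map (from (spec y)) (descendants-convex (to (spec x) χx) (to (spec z) χz) y∈xz)))
      , Fuv , (from (spec v) ancestor-refl , ¬-not (λ χu → no-back-link rv (to (spec u) χu) Fuv))
      , λ { a b (_ , _ , bu) (χb , _) → no-back-link rv (ancestor-trans (to (spec b) χb) bu) Fuv })
    where
    open Equivalence
    below-root : ¬ Ancestor F v r
    below-root (zero , vr) = no-link-into-root (subst (λ t → F u t ≡ true) (walk-zero vr) Fuv)
    below-root (suc _ , vr) = no-link-into-root (proj₂ (proj₂ (walk-last vr)))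

  responsible⇒below-head : ∀ {u v C} → InCG r C → Responsible r F u v C → ∀ x → C x ≡ true → ¬ ¬ Ancestor F v x
  responsible⇒below-head {u} {v} {C} C∈𝒞 (Fuv , (Cv , _) , uncovered) x Cx ¬vx = reachable u λ ru →
    cut-below-head (proj₂ (proj₂ (cut⇒interval r-end C C∈𝒞))) Fuv Cv ru
      (λ y ry yu → stays-outside C u (proj₂ ry) ancestor-refl yu (proj₁ C∈𝒞) uncovered) x Cx ¬vx

-- Drop of a connected link set

module DropOfConnected {n : ℕ} (2≤n : 2 ≤ n) (ea eb r : Fin n) (r-end : Position.IsEnd eb r)
                       (F : DLinks n) (non-shortenable : NonShortenable r ea eb F)
                       {S : ULinks n} (S-sym : ∀ x y → S x y ≡ S y x) (connected : HConnected S)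
                       {w : Fin n} (lca : IsLCA r F (InVS S) w) where
  open Cuts 2≤n eb r
  open NonShortenableSolution 2≤n ea eb r r-end F non-shortenable
  open Equivalence

  cutNonEmpty? : ∀ C → Dec (CutNonEmpty S C)
  cutNonEmpty? C = any? λ x → any? λ y → (S x y ≟ᵇ true) ×-dec ((C x ≟ᵇ true) ×-dec (C y ≟ᵇ false))

  drop⇒rhs : ∀ {u v} → InDrop r F S u v → InRHS F S w u v
  drop⇒rhs {u} {v} (Fuv , drop) = (v , head∈VS , Fuv , refl) , head≢lca ∘ proj₂
    where
    head∈VS : InVS S v
    head∈VS with drop (singleton v) (proj₁ (head-cut Fuv)) (proj₂ (head-cut Fuv))
    ... | x , y , Sxy , Cx , _ = y , inj₁ (subst (λ t → S t y ≡ true) (singleton⇒≡ Cx) Sxy)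

    head≢lca : v ≢ w
    head≢lca v≡w = ¬¬-characteristic (Ancestor F v) λ { (χ , spec) → subtree-cut Fuv χ spec λ { (χ∈𝒞 , responsible) →
      let (x , y , Sxy , χx , χy) = drop χ χ∈𝒞 responsible
      in not-¬ (from (spec y) (subst (λ t → Ancestor F t y) (sym v≡w) (proj₁ lca y (x , inj₂ Sxy)))) χy } }

  rhs⇒drop : ∀ {u v} → InRHS F S w u v → InDrop r F S u v
  rhs⇒drop {u} {v} ((x , x∈VS , Fuv , v≡x) , v≢lca) = Fuv , λ C C∈𝒞 responsible →
    decidable-stable (cutNonEmpty? C) λ uncut →
      ¬¬-∀ (λ y → InVS S y → Ancestor F v y)
        (λ y → ¬¬-→ λ y∈VS → responsible⇒below-head C∈𝒞 responsible y
          (ConnectedLinks.VS-inside 2≤n eb r S-sym (proj₂ (proj₂ (cut⇒interval r-end C C∈𝒞))) uncut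
            connected v∈VS (proj₁ (proj₁ (proj₂ responsible))) y y∈VS))
        λ v-common → v≢lca (Fuv , lca-deepest lca v-common (proj₁ lca v v∈VS))
    where
    v∈VS : InVS S v
    v∈VS = subst (InVS S) (sym v≡x) x∈VS

lemma12 : (n : ℕ) → 3 ≤ n →
    (r ea eb : Fin n) → fwd ea eb ≡ 1 → (ea ≡ r ⊎ eb ≡ r) →
    (L : ULinks n) → IsLinkSet L →
    (F : DLinks n) → (∀ x y → F x y ≡ true → InShadows ea eb L x y) →
    NonShortenable r ea eb F →
    (S : ULinks n) → (∀ x y → S x y ≡ true → L x y ≡ true) →
    (∀ x y → S x y ≡ S y x) → HConnected S →
    (w : Fin n) → IsLCA r F (InVS S) w →
    ∀ u v → (InDrop r F S u v ⇔ InRHS F S w u v)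
lemma12 n 3≤n r ea eb ea→eb r∈er _ _ F _ non-shortenable _ _ S-sym connected _ lca _ _ =
  mk⇔ drop⇒rhs rhs⇒drop
  where
  open DropOfConnected (≤-trans (n≤1+n 2) 3≤n) ea eb r (Position.cut-edge-end eb ea→eb r∈er)
                       F non-shortenable S-sym connected lca
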